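{- Let $k,m,n\geq 2$ and let $\Sigma$ be an alphabet with $|\Sigma|=k$. The $(m,n)_k$-ring graph has exactly $\mathrm{M}(k^n,m)$ edges.
   Context: $\mathrm{M}(q,m)=\frac1m\sum_{d\mid m}\mu(m/d)q^d$ is the necklace polynomial ($\mu$ the Möbius function). $\Sigma$ is a finite totally ordered alphabet; $\Sigma^{m,n}$ denotes the set of $m\times n$ arrays (patterns) over $\Sigma$, and for arrays $X,Y$ with the same number of rows $[X,Y]$ denotes horizontal concatenation. For a pattern $P$ with rows $r_1,\dots,r_m\in\Sigma^{n}$, view $P$ as the word $[r_1,\dots,r_m]$ over the alphabet $\Sigma^n$ (ordered lexicographically). $P$ is row-Lyndon if this word is a Lyndon word (strictly smaller lexicographically than all its nontrivial cyclic rotations). $lexmin(P)$ denotes the cyclic rotation of the rows of $P$ whose corresponding word is lexicographically smallest. The $(m,n)_k$-ring graph is the labeled multidigraph whose vertex set is $\{lexmin(S)\mid S\in\Sigma^{m,n-1}\}$ and which, for vertices $P_1,P_2$, has one edge from $P_1$ to $P_2$ with label $R$ for each $R\in\Sigma^{m,1}$ such that there exist $L\in\Sigma^{m,1}$, $C\in\Sigma^{m,n-2}$ with: (1) $P_1=[L,C]$ and $P_2=lexmin([C,R])$; (2) $lexmin([L,C,R])$ is a row-Lyndon pattern of shape $(m,n)$; (3) there is no $R'\in\Sigma^{m,1}$ with $R'<R$ and $lexmin([L,C,R'])=lexmin([L,C,R])$. (Distinct applicable labels give distinct parallel edges.) -}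

module Defs where

open import Data.Nat as ℕ using (ℕ; zero; suc; _+_; _*_; _∸_; _^_)
open import Data.Nat.Properties using (+-comm; +-suc)
open import Data.Nat.Divisibility using (_∣?_)
open import Data.Nat.Primality using (prime?)
open import Data.Nat.DivMod using (_/_)
open import Data.Fin as Fin using (Fin; toℕ)
open import Data.Vec as Vec using (Vec; []; _∷_; _∷ʳ_; _++_)
open import Data.Vec.Properties using (≡-dec)
open import Data.List as List using (List; []; _∷_; length; map; concatMap; allFin; upTo; filterᵇ)
open import Data.Bool using (Bool; true; false; _∧_; not; if_then_else_)
open import Data.Integer as ℤ using (ℤ; +_; -_)
open import Relation.Nullary.Decidable using (⌊_⌋)
open import Relation.Binary.PropositionalEquality using (_≡_; refl; cong)

data Cmp : Set where
  lt eq gt : Cmp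

isLt : Cmp → Bool
isLt lt = true
isLt _  = false

cmpℕ : ℕ → ℕ → Cmp
cmpℕ zero    zero    = eq
cmpℕ zero    (suc _) = lt
cmpℕ (suc _) zero    = gt
cmpℕ (suc a) (suc b) = cmpℕ a b

cmpLex : {A : Set} {n : ℕ} → (A → A → Cmp) → Vec A n → Vec A n → Cmp
cmpLex c []       []       = eq
cmpLex c (x ∷ xs) (y ∷ ys) with c x y
... | lt = lt
... | gt = gt
... | eq = cmpLex c xs ys

-- an m × n pattern over Σ = Fin k, stored as its list of m rows
Pattern : ℕ → ℕ → ℕ → Set
Pattern k m n = Vec (Vec (Fin k) n) m

cmpΣ : {k : ℕ} → Fin k → Fin k → Cmp
cmpΣ a b = cmpℕ (toℕ a) (toℕ b)

cmpRow : {k n : ℕ} → Vec (Fin k) n → Vec (Fin k) n → Cmp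
cmpRow = cmpLex cmpΣ

cmpPat : {k m n : ℕ} → Pattern k m n → Pattern k m n → Cmp
cmpPat = cmpLex cmpRow

_<ᵖ_ : {k m n : ℕ} → Pattern k m n → Pattern k m n → Bool
P <ᵖ Q = isLt (cmpPat P Q)

_≟ᵖ_ : {k m n : ℕ} → Pattern k m n → Pattern k m n → Bool
P ≟ᵖ Q = ⌊ ≡-dec (≡-dec Fin._≟_) P Q ⌋

hcat : {k m a b : ℕ} → Pattern k m a → Pattern k m b → Pattern k m (a + b)
hcat = Vec.zipWith _++_

castW : {k m a b : ℕ} → a ≡ b → Pattern k m a → Pattern k m b
castW e = Vec.map (Vec.cast e)

rot1 : {A : Set} {m : ℕ} → Vec A m → Vec A m
rot1 []       = []
rot1 (x ∷ xs) = xs ∷ʳ x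

-- rotation by i : [r_{i+1}, …, r_m, r_1, …, r_i]
rot : {A : Set} {m : ℕ} → ℕ → Vec A m → Vec A m
rot zero    w = w
rot (suc i) w = rot i (rot1 w)

allB : {A : Set} → (A → Bool) → List A → Bool
allB p []       = true
allB p (x ∷ xs) = p x ∧ allB p xs

anyB : {A : Set} → (A → Bool) → List A → Bool
anyB p []       = false
anyB p (x ∷ xs) = if p x then true else anyB p xs

-- P is row-Lyndon: strictly smaller than all its nontrivial cyclic
-- rotations (rotation by i, 1 ≤ i ≤ m - 1)
isRowLyndon : {k m n : ℕ} → Pattern k m n → Bool
isRowLyndon {m = m} P = allB (λ i → P <ᵖ rot (suc i) P) (upTo (m ∸ 1))

minPat : {k m n : ℕ} → Pattern k m n → Pattern k m n → Pattern k m n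
minPat P Q = if Q <ᵖ P then Q else P

lexmin : {k m n : ℕ} → Pattern k m n → Pattern k m n
lexmin {m = m} P = List.foldr minPat P (map (λ i → rot i P) (upTo m))

allVecs : {A : Set} → List A → (n : ℕ) → List (Vec A n)
allVecs xs zero    = [] ∷ []
allVecs xs (suc n) = concatMap (λ x → map (x ∷_) (allVecs xs n)) xs

allPat : (k m n : ℕ) → List (Pattern k m n)
allPat k m n = allVecs (allVecs (allFin k) n) m

-- The (m,n)_k-ring graph, for n = n' + 2 (so vertices have width n' + 1,
-- C has width n', labels have width 1)

isVertex : {k m n' : ℕ} → Pattern k m (suc n') → Bool
isVertex {k} {m} {n'} P = anyB (λ S → lexmin S ≟ᵖ P) (allPat k m (suc n'))

catCR : {k m n' : ℕ} → Pattern k m n' → Pattern k m 1 → Pattern k m (suc n')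
catCR {n' = n'} C R = castW (+-comm n' 1) (hcat C R)

catLCR : {k m n' : ℕ} → Pattern k m 1 → Pattern k m n' → Pattern k m 1 →
         Pattern k m (suc (suc n'))
catLCR L C R = hcat L (catCR C R)

isEdge : {k m n' : ℕ} → Pattern k m (suc n') → Pattern k m (suc n') →
         Pattern k m 1 → Bool
isEdge {k} {m} {n'} P₁ P₂ R =
  anyB (λ L → anyB (λ C →
      (P₁ ≟ᵖ hcat L C)
    ∧ (P₂ ≟ᵖ lexmin (catCR C R))
    ∧ isRowLyndon (lexmin (catLCR L C R))
    ∧ not (anyB (λ R' → (R' <ᵖ R)
                      ∧ (lexmin (catLCR L C R') ≟ᵖ lexmin (catLCR L C R)))
                (allPat k m 1)))
    (allPat k m n')) (allPat k m 1)

-- number of edges of the (m,n)_k-ring graph: one edge for each triple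
-- (P₁, P₂, R) of vertices P₁, P₂ and label R satisfying (1)–(3).
-- (Junk value 0 for n < 2.)
ringGraphEdges : (k m n : ℕ) → ℕ
ringGraphEdges k m zero          = 0
ringGraphEdges k m (suc zero)    = 0
ringGraphEdges k m (suc (suc n')) =
  length (filterᵇ (λ t → triple t)
    (concatMap (λ P₁ → concatMap (λ P₂ → map (λ R → P₁ , P₂ , R)
        (allPat k m 1)) (allPat k m (suc n'))) (allPat k m (suc n'))))
  where
  open import Data.Product using (_×_; _,_)
  triple : Pattern k m (suc n') × Pattern k m (suc n') × Pattern k m 1 → Bool
  triple (P₁ , P₂ , R) = isVertex P₁ ∧ isVertex P₂ ∧ isEdge P₁ P₂ R

countB : {A : Set} → (A → Bool) → List A → ℕ
countB p xs = length (filterᵇ p xs)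

range1 : ℕ → List ℕ
range1 n = map suc (upTo n)

squarefree : ℕ → Bool
squarefree n = allB (λ d → not ⌊ (suc (suc d) * suc (suc d)) ∣? n ⌋) (upTo n)

ω : ℕ → ℕ
ω n = countB (λ p → ⌊ prime? p ⌋ ∧ ⌊ p ∣? n ⌋) (range1 n)

μ : ℕ → ℤ
μ n = if squarefree n then (ℤ.- (+ 1)) ℤ.^ ω n else + 0

-- M(q,m) = (1/m) Σ_{d ∣ m} μ(m/d) q^d   (junk value 0 at m = 0)
necklace : ℕ → ℕ → ℤ
necklace q zero    = + 0
necklace q (suc m) =
  List.foldr ℤ._+_ (+ 0)
    (map (λ i → if ⌊ suc i ∣? suc m ⌋
                  then μ (suc m / suc i) ℤ.* (+ q) ℤ.^ suc i
                  else + 0)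
         (upTo (suc m)))
  ℤ./ (+ suc m)

{-# OPTIONS --safe #-}
module Submission where

-- An edge (P₁ , P₂ , R) of the ring graph determines the row-Lyndon pattern Q = lexmin [P₁ , R], and Q
-- determines the edge back: P₁ = [L , C] is the least rotation of Q without its last column, and R is the
-- least column with lexmin [L , C , R] = Q.  Hence the edges are counted by the Lyndon words L(m) of length m
-- over the alphabet Σⁿ of size q = kⁿ.  Sorting all q^m words by their least rotational period d ∣ m, the
-- words of period d correspond to pairs (Lyndon word of length d, rotation), so Σ_{d ∣ m} d L(d) = q^m, and
-- Möbius inversion gives m L(m) = Σ_{d ∣ m} μ(m/d) q^d.

open import Algebra.Structures using (IsCommutativeSemiring)
open import Data.Bool using (Bool; true; false; if_then_else_; _∧_; not)
open import Data.Bool.Properties using (⇔→≡; ∧-conicalˡ; ∧-conicalʳ; ∧-zeroʳ)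
open import Data.Empty using (⊥-elim)
open import Data.Fin as Fin using (Fin; toℕ; fromℕ<)
import Data.Fin.Properties as FinP
open import Data.List as List using (List; []; _∷_; _++_; map; foldr; concatMap; upTo; allFin; cartesianProduct; cartesianProductWith; length)
import Data.List.Properties as ListP
open import Data.List.Membership.Propositional using (_∈_)
open import Data.List.Membership.Propositional.Properties using (∈-map⁺; ∈-map⁻; ∈-upTo⁺; ∈-upTo⁻; ∈-tabulate⁺; ∈-cartesianProductWith⁺)
open import Data.List.Relation.Unary.All as All using (All; []; _∷_)
open import Data.List.Relation.Unary.Any using (here; there)
open import Data.List.Relation.Unary.AllPairs using ([]; _∷_)
open import Data.List.Relation.Unary.Unique.Propositional using (Unique)
import Data.List.Relation.Unary.Unique.Propositional.Properties as UniqueP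
open import Data.Nat as ℕ using (ℕ; zero; suc; z≤n; s≤s; _+_; _*_; _∸_; _%_; _/_; _<_; _≤_; _^_)
import Data.Nat.Properties as ℕP
open import Data.Nat.Divisibility
  using (_∣_; _∣?_; divides; m%n≡0⇒n∣m; ∣-refl; ∣-trans; ∣⇒≤; 0∣⇒≡0; m∣m*n; n∣m*n; *-monoʳ-∣; *-cancelˡ-∣; *-pres-∣)
open import Data.Nat.DivMod
  using (m*n/n≡m; m/n*n≡m; m*n%n≡0; m%n<n; m<n⇒m%n≡m; m%n%n≡m%n; [m+kn]%n≡m%n; %-distribˡ-+; n%n≡0; m≡m%n+[m/n]*n; m∣n⇒o%n%m≡o%m)
open import Data.Nat.Coprimality using (Coprime; coprime-divisor)
open import Data.Nat.ListAction using (product)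
open import Data.Nat.Primality using (Prime; prime?; euclidsLemma; prime⇒irreducible; ¬prime[0]; ¬prime[1])
open import Data.Nat.Primality.Factorisation using (factorise; PrimeFactorisation)
open import Data.Sum using (_⊎_; inj₁; inj₂)
open import Data.Product using (∃-syntax; _×_; _,_; proj₁; proj₂)
import Data.Product.Properties as ProdP
open import Data.Vec as Vec using (Vec; []; _∷_; _∷ʳ_; lookup; tabulate)
import Data.Vec.Properties as VecP
open import Function using (_∘_; id; mk⇔)
open import Relation.Binary.Definitions using (DecidableEquality; tri<; tri≈; tri>)
open import Relation.Binary.PropositionalEquality
open import Relation.Nullary using (¬_; Dec; yes; no)
open import Relation.Nullary.Decidable using (⌊_⌋)

open import Defs

⌊⌋-true : {P : Set} (P? : Dec P) → P → ⌊ P? ⌋ ≡ true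
⌊⌋-true (yes _) _ = refl
⌊⌋-true (no ¬p) p = ⊥-elim (¬p p)

⌊⌋-false : {P : Set} (P? : Dec P) → ¬ P → ⌊ P? ⌋ ≡ false
⌊⌋-false (yes p) ¬p = ⊥-elim (¬p p)
⌊⌋-false (no _) _ = refl

⌊⌋-true⁻ : {P : Set} (P? : Dec P) → ⌊ P? ⌋ ≡ true → P
⌊⌋-true⁻ (yes p) _ = p

⌊⌋-false⁻ : {P : Set} (P? : Dec P) → ⌊ P? ⌋ ≡ false → ¬ P
⌊⌋-false⁻ (no ¬p) _ = ¬p

false≢true : false ≢ true
false≢true ()

≡true-ext : {a b : Bool} → (a ≡ true → b ≡ true) → (b ≡ true → a ≡ true) → a ≡ b
≡true-ext a⇒b b⇒a = ⇔→≡ (mk⇔ a⇒b b⇒a)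

record Enumerates {A : Set} (xs : List A) : Set where
  field
    unique   : Unique xs
    complete : ∀ a → a ∈ xs

concatMap-map≡cartesianProductWith : {A B C : Set} (f : A → B → C) (xs : List A) (ys : List B) →
  concatMap (λ x → map (f x) ys) xs ≡ cartesianProductWith f xs ys
concatMap-map≡cartesianProductWith f []       ys = refl
concatMap-map≡cartesianProductWith f (x ∷ xs) ys = cong (map (f x) ys ++_) (concatMap-map≡cartesianProductWith f xs ys)

length-cartesianProductWith : {A B C : Set} (f : A → B → C) (xs : List A) (ys : List B) →
  length (cartesianProductWith f xs ys) ≡ length xs * length ys
length-cartesianProductWith f []       ys = refl
length-cartesianProductWith f (x ∷ xs) ys = begin
  length (map (f x) ys ++ cartesianProductWith f xs ys)  ≡⟨ ListP.length-++ (map (f x) ys) ⟩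
  length (map (f x) ys) + length (cartesianProductWith f xs ys)
    ≡⟨ cong₂ _+_ (ListP.length-map (f x) ys) (length-cartesianProductWith f xs ys) ⟩
  length ys + length xs * length ys  ∎
  where open ≡-Reasoning

cartesianProductWith-enumerates : {A B C : Set} (f : A → B → C) →
  (∀ {a a' b b'} → f a b ≡ f a' b' → a ≡ a' × b ≡ b') → (∀ c → ∃[ a ] ∃[ b ] c ≡ f a b) →
  {xs : List A} {ys : List B} → Enumerates xs → Enumerates ys → Enumerates (cartesianProductWith f xs ys)
cartesianProductWith-enumerates f f-injective f-onto exs eys = record
  { unique   = UniqueP.cartesianProductWith⁺ f f-injective (Enumerates.unique exs) (Enumerates.unique eys)
  ; complete = λ c → let (a , b , c≡fab) = f-onto c in
      subst (_∈ _) (sym c≡fab) (∈-cartesianProductWith⁺ f (Enumerates.complete exs a) (Enumerates.complete eys b))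
  }

cartesianProduct-enumerates : {A B : Set} {xs : List A} {ys : List B} →
  Enumerates xs → Enumerates ys → Enumerates (cartesianProduct xs ys)
cartesianProduct-enumerates = cartesianProductWith-enumerates _,_ (λ { refl → refl , refl }) (λ (a , b) → a , b , refl)

allFin-enumerates : (k : ℕ) → Enumerates (allFin k)
allFin-enumerates k = record { unique = UniqueP.allFin⁺ k ; complete = ∈-tabulate⁺ }

allVecs-enumerates : {A : Set} {xs : List A} → Enumerates xs → (n : ℕ) → Enumerates (allVecs xs n)
allVecs-enumerates exs zero = record { unique = [] ∷ [] ; complete = λ { [] → here refl } }
allVecs-enumerates {xs = xs} exs (suc n) =
  subst Enumerates (sym (concatMap-map≡cartesianProductWith _∷_ xs (allVecs xs n)))
    (cartesianProductWith-enumerates _∷_ VecP.∷-injective (λ { (a ∷ as) → a , as , refl }) exs (allVecs-enumerates exs n))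

allPat-enumerates : (k m n : ℕ) → Enumerates (allPat k m n)
allPat-enumerates k m n = allVecs-enumerates (allVecs-enumerates (allFin-enumerates k) n) m

length-allVecs : {A : Set} (xs : List A) (n : ℕ) → length (allVecs xs n) ≡ length xs ^ n
length-allVecs xs zero    = refl
length-allVecs xs (suc n) = begin
  length (concatMap (λ x → map (x ∷_) (allVecs xs n)) xs)
    ≡⟨ cong length (concatMap-map≡cartesianProductWith _∷_ xs (allVecs xs n)) ⟩
  length (cartesianProductWith _∷_ xs (allVecs xs n))  ≡⟨ length-cartesianProductWith _∷_ xs (allVecs xs n) ⟩
  length xs * length (allVecs xs n)                    ≡⟨ cong (length xs *_) (length-allVecs xs n) ⟩
  length xs * length xs ^ n                            ∎
  where open ≡-Reasoning

length-allPat : (k m n : ℕ) → length (allPat k m n) ≡ (k ^ n) ^ m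
length-allPat k m n = begin
  length (allPat k m n)                   ≡⟨ length-allVecs _ m ⟩
  length (allVecs (allFin k) n) ^ m       ≡⟨ cong (_^ m) (length-allVecs (allFin k) n) ⟩
  (length (allFin k) ^ n) ^ m             ≡⟨ cong (λ l → (l ^ n) ^ m) (ListP.length-tabulate id) ⟩
  (k ^ n) ^ m                             ∎
  where open ≡-Reasoning

range1-unique : (N : ℕ) → Unique (range1 N)
range1-unique N = UniqueP.map⁺ ℕP.suc-injective (UniqueP.upTo⁺ N)

∈-range1 : {N d : ℕ} → 0 < d → d ≤ N → d ∈ range1 N
∈-range1 {N} {suc d} _ d<N = ∈-map⁺ suc (∈-upTo⁺ d<N)

-- Finite sums over lists

record SubsetBijection {A B : Set} (p : A → Bool) (q : B → Bool) : Set where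
  field
    to      : A → B
    from    : B → A
    to-∈    : ∀ {a} → p a ≡ true → q (to a) ≡ true
    from-∈  : ∀ {b} → q b ≡ true → p (from b) ≡ true
    from-to : ∀ {a} → p a ≡ true → from (to a) ≡ a
    to-from : ∀ {b} → q b ≡ true → to (from b) ≡ b

id-bijection : {A : Set} (p : A → Bool) → SubsetBijection p p
id-bijection p = record { to = id ; from = id ; to-∈ = id ; from-∈ = id ; from-to = λ _ → refl ; to-from = λ _ → refl }

module ListSum {R : Set} {_+_ _*_ : R → R → R} {0# 1# : R}
               (isCS : IsCommutativeSemiring _≡_ _+_ _*_ 0# 1#) where

  open IsCommutativeSemiring isCS using (+-assoc; +-comm; +-identityˡ; +-identityʳ; *-comm; distribˡ; zeroʳ)

  ∑ : {A : Set} → List A → (A → R) → R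
  ∑ xs f = foldr _+_ 0# (map f xs)

  𝟙 : Bool → R
  𝟙 b = if b then 1# else 0#

  ∑-0 : {A : Set} (xs : List A) → ∑ xs (λ _ → 0#) ≡ 0#
  ∑-0 []       = refl
  ∑-0 (x ∷ xs) = trans (+-identityˡ _) (∑-0 xs)

  ∑-cong : {A : Set} (xs : List A) {f g : A → R} → (∀ x → f x ≡ g x) → ∑ xs f ≡ ∑ xs g
  ∑-cong []       f≗g = refl
  ∑-cong (x ∷ xs) f≗g = cong₂ _+_ (f≗g x) (∑-cong xs f≗g)

  ∑-map : {A B : Set} (g : B → A) (xs : List B) (f : A → R) → ∑ (map g xs) f ≡ ∑ xs (f ∘ g)
  ∑-map g []       f = refl
  ∑-map g (x ∷ xs) f = cong (f (g x) +_) (∑-map g xs f)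

  ∑-+ : {A : Set} (xs : List A) (f g : A → R) → ∑ xs (λ x → f x + g x) ≡ ∑ xs f + ∑ xs g
  ∑-+ []       f g = sym (+-identityˡ 0#)
  ∑-+ (x ∷ xs) f g = begin
    (f x + g x) + ∑ xs (λ y → f y + g y)  ≡⟨ cong ((f x + g x) +_) (∑-+ xs f g) ⟩
    (f x + g x) + (∑ xs f + ∑ xs g)       ≡⟨ +-assoc (f x) (g x) _ ⟩
    f x + (g x + (∑ xs f + ∑ xs g))       ≡⟨ cong (f x +_) (sym (+-assoc (g x) (∑ xs f) _)) ⟩
    f x + ((g x + ∑ xs f) + ∑ xs g)       ≡⟨ cong (λ t → f x + (t + ∑ xs g)) (+-comm (g x) (∑ xs f)) ⟩
    f x + ((∑ xs f + g x) + ∑ xs g)       ≡⟨ cong (f x +_) (+-assoc (∑ xs f) (g x) _) ⟩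
    f x + (∑ xs f + (g x + ∑ xs g))       ≡⟨ sym (+-assoc (f x) (∑ xs f) _) ⟩
    (f x + ∑ xs f) + (g x + ∑ xs g)       ∎
    where open ≡-Reasoning

  ∑-*ˡ : {A : Set} (xs : List A) (c : R) (f : A → R) → ∑ xs (λ x → c * f x) ≡ c * ∑ xs f
  ∑-*ˡ []       c f = sym (zeroʳ c)
  ∑-*ˡ (x ∷ xs) c f = trans (cong ((c * f x) +_) (∑-*ˡ xs c f)) (sym (distribˡ c (f x) _))

  ∑-*ʳ : {A : Set} (xs : List A) (c : R) (f : A → R) → ∑ xs (λ x → f x * c) ≡ ∑ xs f * c
  ∑-*ʳ xs c f = trans (∑-cong xs (λ x → *-comm (f x) c)) (trans (∑-*ˡ xs c f) (*-comm c (∑ xs f)))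

  ∑-swap : {A B : Set} (xs : List A) (ys : List B) (h : A → B → R) →
    ∑ xs (λ x → ∑ ys (h x)) ≡ ∑ ys (λ y → ∑ xs (λ x → h x y))
  ∑-swap []       ys h = sym (∑-0 ys)
  ∑-swap (x ∷ xs) ys h =
    trans (cong (∑ ys (h x) +_) (∑-swap xs ys h)) (sym (∑-+ ys (h x) (λ y → ∑ xs (λ x' → h x' y))))

  module _ {A : Set} (_≟_ : DecidableEquality A) where

    ∑-absent : {a : A} {xs : List A} (f : A → R) → All (a ≢_) xs →
      ∑ xs (λ x → if ⌊ x ≟ a ⌋ then f x else 0#) ≡ 0#
    ∑-absent f [] = refl
    ∑-absent {a} f (_∷_ {x} a≢x a∉xs) with x ≟ a
    ... | yes x≡a = ⊥-elim (a≢x (sym x≡a))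
    ... | no _    = trans (+-identityˡ _) (∑-absent f a∉xs)

    ∑-pick : {a : A} {xs : List A} (f : A → R) → Unique xs → a ∈ xs →
      ∑ xs (λ x → if ⌊ x ≟ a ⌋ then f x else 0#) ≡ f a
    ∑-pick {a} f (a∉xs ∷ _) (here refl) with a ≟ a
    ... | yes _  = trans (cong (f a +_) (∑-absent f a∉xs)) (+-identityʳ (f a))
    ... | no a≢a = ⊥-elim (a≢a refl)
    ∑-pick {a} f (_∷_ {x} x∉xs xs-unique) (there a∈xs) with x ≟ a
    ... | yes refl = ⊥-elim (All.lookup x∉xs a∈xs refl)
    ... | no _     = trans (+-identityˡ _) (∑-pick f xs-unique a∈xs)

  ∑-bijection : {A B : Set} (_≟A_ : DecidableEquality A) (_≟B_ : DecidableEquality B)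
    {p : A → Bool} {q : B → Bool} (β : SubsetBijection p q) {xs : List A} {ys : List B} →
    Unique xs → (∀ {a} → p a ≡ true → a ∈ xs) → Unique ys → (∀ {b} → q b ≡ true → b ∈ ys) →
    (h : B → R) → ∑ xs (λ a → if p a then h (SubsetBijection.to β a) else 0#) ≡ ∑ ys (λ b → if q b then h b else 0#)
  ∑-bijection {A} {B} _≟A_ _≟B_ {p} {q} β {xs} {ys} xs-unique p⊆xs ys-unique q⊆ys h = begin
    ∑ xs (λ a → if p a then h (to a) else 0#)      ≡⟨ ∑-cong xs expand ⟩
    ∑ xs (λ a → ∑ ys (λ b → T a b))                 ≡⟨ ∑-swap xs ys T ⟩
    ∑ ys (λ b → ∑ xs (λ a → T a b))                 ≡⟨ ∑-cong ys collapse ⟩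
    ∑ ys (λ b → if q b then h b else 0#)            ∎
    where
    open ≡-Reasoning
    open SubsetBijection β

    T : A → B → R
    T a b = if p a ∧ ⌊ b ≟B to a ⌋ then h b else 0#

    expand : ∀ a → (if p a then h (to a) else 0#) ≡ ∑ ys (T a)
    expand a with p a in pa
    ... | true  = sym (∑-pick _≟B_ h ys-unique (q⊆ys (to-∈ pa)))
    ... | false = sym (∑-0 ys)

    collapse : ∀ b → ∑ xs (λ a → T a b) ≡ (if q b then h b else 0#)
    collapse b with q b in qb
    ... | true = trans (∑-cong xs (λ a → cong (λ c → if c then h b else 0#) (T≡ a)))
                       (∑-pick _≟A_ (λ _ → h b) xs-unique (p⊆xs (from-∈ qb)))
      where
      T≡ : ∀ a → (p a ∧ ⌊ b ≟B to a ⌋) ≡ ⌊ a ≟A from b ⌋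
      T≡ a = ≡true-ext
        (λ h → let b≡ = ⌊⌋-true⁻ (b ≟B to a) (∧-conicalʳ _ _ h) in
               ⌊⌋-true (a ≟A from b) (trans (sym (from-to (∧-conicalˡ _ _ h))) (cong from (sym b≡))))
        (λ h → let a≡ = ⌊⌋-true⁻ (a ≟A from b) h in
               cong₂ _∧_ (trans (cong p a≡) (from-∈ qb)) (⌊⌋-true (b ≟B to a) (trans (sym (to-from qb)) (cong to (sym a≡)))))
    ... | false = trans (∑-cong xs T≡0) (∑-0 xs)
      where
      T≡0 : ∀ a → T a b ≡ 0#
      T≡0 a with p a in pa | b ≟B to a
      ... | true  | yes refl with () ← trans (sym qb) (to-∈ pa)
      ... | true  | no _     = refl
      ... | false | _        = refl

  ∑-if : {A : Set} (xs : List A) (b : Bool) (f : A → R) → ∑ xs (λ x → if b then f x else 0#) ≡ (if b then ∑ xs f else 0#)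
  ∑-if xs true  f = refl
  ∑-if xs false f = ∑-0 xs

  ∑-support : {A : Set} (_≟_ : DecidableEquality A) (p : A → Bool) {xs ys : List A} →
    Unique xs → (∀ {a} → p a ≡ true → a ∈ xs) → Unique ys → (∀ {a} → p a ≡ true → a ∈ ys) →
    (h : A → R) → ∑ xs (λ a → if p a then h a else 0#) ≡ ∑ ys (λ a → if p a then h a else 0#)
  ∑-support _≟_ p = ∑-bijection _≟_ _≟_ (id-bijection p)

  divisorSum : ℕ → (ℕ → R) → R
  divisorSum N f = ∑ (range1 N) (λ d → if ⌊ d ∣? N ⌋ then f d else 0#)

  divisorSum-cong : (N : ℕ) {f g : ℕ → R} → (∀ {d} → d ∣ N → f d ≡ g d) → divisorSum N f ≡ divisorSum N g
  divisorSum-cong N f≗g = ∑-cong (range1 N) pointwise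
    where
    pointwise : ∀ d → (if ⌊ d ∣? N ⌋ then _ else 0#) ≡ (if ⌊ d ∣? N ⌋ then _ else 0#)
    pointwise d with d ∣? N
    ... | yes d∣N = f≗g d∣N
    ... | no _    = refl

  divisorSum-∑ : {A : Set} (N : ℕ) (xs : List A) (g : ℕ → A → R) →
    divisorSum N (λ d → ∑ xs (g d)) ≡ ∑ xs (λ x → divisorSum N (λ d → g d x))
  divisorSum-∑ N xs g = trans (∑-cong (range1 N) (λ d → sym (∑-if xs ⌊ d ∣? N ⌋ (g d))))
                              (∑-swap (range1 N) xs (λ d x → if ⌊ d ∣? N ⌋ then g d x else 0#))

-- Imported only now: in ListSum, sections such as (x +_) would be ambiguous with ℤ's constructor +_.
open import Data.Integer as ℤ using (ℤ; +_; -_; 0ℤ; 1ℤ)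
import Data.Integer.Properties as ℤP

open ListSum ℤP.+-*-isCommutativeSemiring

+-countB : {A : Set} (p : A → Bool) (xs : List A) → + countB p xs ≡ ∑ xs (𝟙 ∘ p)
+-countB p []       = refl
+-countB p (x ∷ xs) with p x
... | true  = trans (ℤP.pos-+ 1 (countB p xs)) (cong (λ t → 1ℤ ℤ.+ t) (+-countB p xs))
... | false = trans (+-countB p xs) (sym (ℤP.+-identityˡ _))

+-length : {A : Set} (xs : List A) → + length xs ≡ ∑ xs (λ _ → 1ℤ)
+-length []       = refl
+-length (x ∷ xs) = trans (ℤP.pos-+ 1 (length xs)) (cong (λ t → 1ℤ ℤ.+ t) (+-length xs))

∑-neg : {A : Set} (xs : List A) (f : A → ℤ) → ∑ xs (λ x → - f x) ≡ - ∑ xs f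
∑-neg []       f = refl
∑-neg (x ∷ xs) f = trans (cong (λ t → - f x ℤ.+ t) (∑-neg xs f)) (sym (ℤP.neg-distrib-+ (f x) _))

countB-bijection : {A B : Set} (_≟A_ : DecidableEquality A) (_≟B_ : DecidableEquality B)
  {p : A → Bool} {q : B → Bool} → SubsetBijection p q →
  {xs : List A} {ys : List B} → Enumerates xs → Enumerates ys → countB p xs ≡ countB q ys
countB-bijection _≟A_ _≟B_ {p} {q} β {xs} {ys} exs eys = ℤP.+-injective (begin
  + countB p xs  ≡⟨ +-countB p xs ⟩
  ∑ xs (𝟙 ∘ p)   ≡⟨ ∑-bijection _≟A_ _≟B_ β (Enumerates.unique exs) (λ _ → Enumerates.complete exs _)
                                             (Enumerates.unique eys) (λ _ → Enumerates.complete eys _) (λ _ → 1ℤ) ⟩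
  ∑ ys (𝟙 ∘ q)   ≡⟨ sym (+-countB q ys) ⟩
  + countB q ys  ∎)
  where open ≡-Reasoning

allB⁺ : {A : Set} (p : A → Bool) (xs : List A) → (∀ {a} → a ∈ xs → p a ≡ true) → allB p xs ≡ true
allB⁺ p []       _   = refl
allB⁺ p (x ∷ xs) all = cong₂ _∧_ (all (here refl)) (allB⁺ p xs (all ∘ there))

allB⁻ : {A : Set} (p : A → Bool) (xs : List A) → allB p xs ≡ true → ∀ {a} → a ∈ xs → p a ≡ true
allB⁻ p (x ∷ xs) h (here refl) = ∧-conicalˡ _ _ h
allB⁻ p (x ∷ xs) h (there a∈xs) = allB⁻ p xs (∧-conicalʳ _ _ h) a∈xs

anyB⁺ : {A : Set} (p : A → Bool) (xs : List A) {a : A} → a ∈ xs → p a ≡ true → anyB p xs ≡ true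
anyB⁺ p (x ∷ xs) (here refl) pa rewrite pa = refl
anyB⁺ p (x ∷ xs) (there a∈xs) pa with p x
... | true  = refl
... | false = anyB⁺ p xs a∈xs pa

anyB⁻ : {A : Set} (p : A → Bool) (xs : List A) → anyB p xs ≡ true → ∃[ a ] (a ∈ xs × p a ≡ true)
anyB⁻ p (x ∷ xs) h with p x in px
... | true  = x , here refl , px
... | false = let (a , a∈xs , pa) = anyB⁻ p xs h in a , there a∈xs , pa

anyB-false⁻ : {A : Set} (p : A → Bool) (xs : List A) → anyB p xs ≡ false → ∀ {a} → a ∈ xs → p a ≡ false
anyB-false⁻ p (x ∷ xs) h a∈xs with p x in px
anyB-false⁻ p (x ∷ xs) h (here refl)  | false = px
anyB-false⁻ p (x ∷ xs) h (there a∈xs) | false = anyB-false⁻ p xs h a∈xs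

anyB-false⁺ : {A : Set} (p : A → Bool) (xs : List A) → (∀ {a} → a ∈ xs → p a ≡ false) → anyB p xs ≡ false
anyB-false⁺ p []       _    = refl
anyB-false⁺ p (x ∷ xs) none rewrite none (here refl) = anyB-false⁺ p xs (none ∘ there)

∣⇒pos : {d N : ℕ} → 0 < N → d ∣ N → 0 < d
∣⇒pos {zero}  0<N 0∣N = ⊥-elim (ℕP.<-irrefl (sym (0∣⇒≡0 0∣N)) 0<N)
∣⇒pos {suc d} _   _   = s≤s z≤n

∣⇒∈-range1 : {d N M : ℕ} → 0 < N → d ∣ N → N ≤ M → d ∈ range1 M
∣⇒∈-range1 0<N d∣N N≤M = ∈-range1 (∣⇒pos 0<N d∣N) (ℕP.≤-trans (∣⇒≤ {{ℕ.>-nonZero 0<N}} d∣N) N≤M)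

-- _/_ usable with a variable divisor, since no NonZero instance is needed; m ÷ 0 = 0.
_÷_ : ℕ → ℕ → ℕ
m ÷ zero  = zero
m ÷ suc d = m / suc d

*-÷-cancelʳ : (q d : ℕ) → 0 < d → (q * d) ÷ d ≡ q
*-÷-cancelʳ q (suc d) _ = m*n/n≡m q (suc d)

÷-∣ : {d M : ℕ} → d ∣ M → M ≡ (M ÷ d) * d
÷-∣ {zero}  0∣M = 0∣⇒≡0 0∣M
÷-∣ {suc d} d∣M = sym (m/n*n≡m d∣M)

÷-∣-self : {d M : ℕ} → d ∣ M → (M ÷ d) ∣ M
÷-∣-self {d} {M} d∣M = divides d (trans (÷-∣ d∣M) (ℕP.*-comm (M ÷ d) d))

÷-involutive : {d M : ℕ} → 0 < M → d ∣ M → M ÷ (M ÷ d) ≡ d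
÷-involutive {d} {M} 0<M d∣M = begin
  M ÷ (M ÷ d)            ≡⟨ cong (_÷ (M ÷ d)) (trans (÷-∣ d∣M) (ℕP.*-comm (M ÷ d) d)) ⟩
  (d * (M ÷ d)) ÷ (M ÷ d) ≡⟨ *-÷-cancelʳ d (M ÷ d) (∣⇒pos 0<M (÷-∣-self d∣M)) ⟩
  d                      ∎
  where open ≡-Reasoning

-- The Möbius function and Möbius inversion

prime⇒2+ : {p : ℕ} → Prime p → ∃[ p' ] p ≡ 2 + p'
prime⇒2+ {zero}        pp = ⊥-elim (¬prime[0] pp)
prime⇒2+ {suc zero}    pp = ⊥-elim (¬prime[1] pp)
prime⇒2+ {suc (suc p)} _  = p , refl

prime-divisor : (N : ℕ) → 1 < N → ∃[ p ] (Prime p × p ∣ N)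
prime-divisor (suc zero) (s≤s ())
prime-divisor N@(suc (suc _)) _ = first-factor (PrimeFactorisation.isFactorisation fN) (PrimeFactorisation.factorsPrime fN)
  where
  fN : PrimeFactorisation N
  fN = factorise N
  first-factor : {ps : List ℕ} → N ≡ product ps → All Prime ps → ∃[ p ] (Prime p × p ∣ N)
  first-factor {p ∷ ps} N≡ (pp ∷ _) = p , pp , subst (p ∣_) (sym N≡) (m∣m*n (product ps))

prime∤⇒coprime : {p c : ℕ} → Prime p → ¬ p ∣ c → Coprime c p
prime∤⇒coprime pp p∤c (d∣c , d∣p) with prime⇒irreducible pp d∣p
... | inj₁ d≡1 = d≡1
... | inj₂ refl = ⊥-elim (p∤c d∣c)

prime∣prime⇒≡ : {p q : ℕ} → Prime p → Prime q → q ∣ p → q ≡ p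
prime∣prime⇒≡ pp pq q∣p with prime⇒irreducible pp q∣p
... | inj₁ refl = ⊥-elim (¬prime[1] pq)
... | inj₂ q≡p  = q≡p

not≡true⇒≡false : {b : Bool} → not b ≡ true → b ≡ false
not≡true⇒≡false {false} _ = refl

squarefree⁻ : {n : ℕ} → 0 < n → squarefree n ≡ true → {e : ℕ} → 2 ≤ e → ¬ e * e ∣ n
squarefree⁻ _ _ {suc zero} (s≤s ()) _
squarefree⁻ {n} 0<n sf {e@(suc (suc e'))} _ ee∣n =
  ⌊⌋-false⁻ (e * e ∣? n) (not≡true⇒≡false (allB⁻ _ (upTo n) sf (∈-upTo⁺ e'<n))) ee∣n
  where
  e'<n : e' < n
  e'<n = ℕP.<-≤-trans (ℕP.≤-trans (ℕP.n<1+n e') (ℕP.n≤1+n (suc e')))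
           (ℕP.≤-trans (ℕP.m≤m*n e e) (∣⇒≤ {{ℕ.>-nonZero 0<n}} ee∣n))

squarefree⁺ : {n : ℕ} → ({e : ℕ} → 2 ≤ e → ¬ e * e ∣ n) → squarefree n ≡ true
squarefree⁺ {n} no-square = allB⁺ _ (upTo n) (λ _ → cong not (⌊⌋-false (_ ∣? n) (no-square (s≤s (s≤s z≤n)))))

squarefree-*-prime-∣ : {p c : ℕ} → Prime p → 0 < c → p ∣ c → squarefree (p * c) ≡ false
squarefree-*-prime-∣ {p} {c@(suc _)} pp _ p∣c with prime⇒2+ pp | squarefree (p * c) in sf
... | _      | false = refl
... | p' , refl | true = ⊥-elim (squarefree⁻ {p * c} (s≤s z≤n) sf (s≤s (s≤s z≤n)) (*-monoʳ-∣ p p∣c))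

squarefree-*-prime-∤ : {p c : ℕ} → Prime p → 0 < c → ¬ p ∣ c → squarefree (p * c) ≡ squarefree c
squarefree-*-prime-∤ {p} {c@(suc _)} pp _ p∤c with prime⇒2+ pp
... | p' , refl = ≡true-ext
  (λ sf → squarefree⁺ (λ 2≤e ee∣c → squarefree⁻ {p * c} (s≤s z≤n) sf 2≤e (∣-trans ee∣c (n∣m*n p))))
  (λ sf → squarefree⁺ (λ {e} 2≤e ee∣pc → no-square-divisor sf 2≤e ee∣pc))
  where
  no-square-divisor : squarefree c ≡ true → {e : ℕ} → 2 ≤ e → ¬ e * e ∣ p * c
  no-square-divisor sf {e} 2≤e ee∣pc with p ∣? e
  ... | yes p∣e = p∤c (*-cancelˡ-∣ p (∣-trans (*-pres-∣ p∣e p∣e) ee∣pc))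
  ... | no p∤e  = squarefree⁻ {c} (s≤s z≤n) sf 2≤e (coprime-divisor (prime∤⇒coprime pp p∤ee) ee∣pc)
    where
    p∤ee : ¬ p ∣ e * e
    p∤ee p∣ee with euclidsLemma e e pp p∣ee
    ... | inj₁ p∣e = p∤e p∣e
    ... | inj₂ p∣e = p∤e p∣e

isPrimeDivisor : ℕ → ℕ → Bool
isPrimeDivisor n q = ⌊ prime? q ⌋ ∧ ⌊ q ∣? n ⌋

isPrimeDivisor-*-prime : {p c : ℕ} → Prime p → ¬ p ∣ c → ∀ q →
  𝟙 (isPrimeDivisor (p * c) q) ≡ 𝟙 (isPrimeDivisor c q) ℤ.+ 𝟙 ⌊ q ℕ.≟ p ⌋
isPrimeDivisor-*-prime {p} {c} pp p∤c q with prime? q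
... | no ¬pq rewrite ⌊⌋-false (q ℕ.≟ p) (λ { refl → ¬pq pp }) = refl
... | yes pq with q ∣? p * c
...   | no q∤pc rewrite ⌊⌋-false (q ∣? c) (λ q∣c → q∤pc (∣-trans q∣c (n∣m*n p)))
                      | ⌊⌋-false (q ℕ.≟ p) (λ { refl → q∤pc (m∣m*n c) }) = refl
...   | yes q∣pc with euclidsLemma p c pq q∣pc
...     | inj₁ q∣p with refl ← prime∣prime⇒≡ pp pq q∣p
                   rewrite ⌊⌋-false (q ∣? c) p∤c | ⌊⌋-true (q ℕ.≟ q) refl = refl
...     | inj₂ q∣c rewrite ⌊⌋-true (q ∣? c) q∣c | ⌊⌋-false (q ℕ.≟ p) (λ { refl → p∤c q∣c }) = refl

ω-*-prime : {p c : ℕ} → Prime p → 0 < c → ¬ p ∣ c → ω (p * c) ≡ suc (ω c)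
ω-*-prime {p} {c} pp 0<c p∤c with prime⇒2+ pp
... | p' , refl = ℤP.+-injective (begin
  + ω (p * c)                                                      ≡⟨ +-countB (isPrimeDivisor (p * c)) (range1 (p * c)) ⟩
  ∑ (range1 (p * c)) (𝟙 ∘ isPrimeDivisor (p * c))                 ≡⟨ ∑-cong (range1 (p * c)) (isPrimeDivisor-*-prime pp p∤c) ⟩
  ∑ (range1 (p * c)) (λ q → 𝟙 (isPrimeDivisor c q) ℤ.+ 𝟙 ⌊ q ℕ.≟ p ⌋)  ≡⟨ ∑-+ (range1 (p * c)) _ _ ⟩
  ∑ (range1 (p * c)) (𝟙 ∘ isPrimeDivisor c) ℤ.+ ∑ (range1 (p * c)) (λ q → 𝟙 ⌊ q ℕ.≟ p ⌋)
    ≡⟨ cong₂ ℤ._+_ (∑-support ℕ._≟_ (isPrimeDivisor c) (range1-unique (p * c)) (⊆range1 (ℕP.m≤n*m c p))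
                                                        (range1-unique c) (⊆range1 ℕP.≤-refl) (λ _ → 1ℤ))
                   (∑-pick ℕ._≟_ (λ _ → 1ℤ) (range1-unique (p * c))
                      (∣⇒∈-range1 (ℕP.<-≤-trans 0<c (ℕP.m≤n*m c p)) (m∣m*n c) ℕP.≤-refl)) ⟩
  ∑ (range1 c) (𝟙 ∘ isPrimeDivisor c) ℤ.+ 1ℤ
    ≡⟨ cong (λ t → t ℤ.+ 1ℤ) (sym (+-countB (isPrimeDivisor c) (range1 c))) ⟩
  + (ω c + 1)                                                      ≡⟨ cong +_ (ℕP.+-comm (ω c) 1) ⟩
  + suc (ω c)                                                      ∎)
  where
  open ≡-Reasoning
  ⊆range1 : {M q : ℕ} → c ≤ M → isPrimeDivisor c q ≡ true → q ∈ range1 M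
  ⊆range1 {q = q} c≤M isPD = ∣⇒∈-range1 0<c (⌊⌋-true⁻ (q ∣? c) (∧-conicalʳ _ _ isPD)) c≤M

μ-*-prime-∣ : {p c : ℕ} → Prime p → 0 < c → p ∣ c → μ (p * c) ≡ 0ℤ
μ-*-prime-∣ pp 0<c p∣c rewrite squarefree-*-prime-∣ pp 0<c p∣c = refl

μ-*-prime-∤ : {p c : ℕ} → Prime p → 0 < c → ¬ p ∣ c → μ (p * c) ≡ - μ c
μ-*-prime-∤ {c = c} pp 0<c p∤c rewrite squarefree-*-prime-∤ pp 0<c p∤c | ω-*-prime pp 0<c p∤c with squarefree c
... | true  = ℤP.-1*i≡-i _
... | false = refl

if-split : (b c : Bool) (x : ℤ) →
  (if b then x else 0ℤ) ≡ (if b ∧ not c then x else 0ℤ) ℤ.+ (if b ∧ c then x else 0ℤ)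
if-split false c     x = refl
if-split true  false x = sym (ℤP.+-identityʳ x)
if-split true  true  x = sym (ℤP.+-identityˡ x)

*-if : (c : ℤ) (b : Bool) (x : ℤ) → c ℤ.* (if b then x else 0ℤ) ≡ (if b then c ℤ.* x else 0ℤ)
*-if c true  x = refl
*-if c false x = ℤP.*-zeroʳ c

if-* : (b : Bool) (x c : ℤ) → (if b then x else 0ℤ) ℤ.* c ≡ (if b then x ℤ.* c else 0ℤ)
if-* true  x c = refl
if-* false x c = refl

𝟙-* : (b : Bool) (x : ℤ) → 𝟙 b ℤ.* x ≡ (if b then x else 0ℤ)
𝟙-* true  x = ℤP.*-identityˡ x
𝟙-* false x = refl

divisorSum-as-∑ : {d M : ℕ} → 0 < d → d ≤ M → (f : ℕ → ℤ) →
  divisorSum d f ≡ ∑ (range1 M) (λ e → if ⌊ e ∣? d ⌋ then f e else 0ℤ)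
divisorSum-as-∑ {d} {M} 0<d d≤M = ∑-support ℕ._≟_ (λ e → ⌊ e ∣? d ⌋)
  (range1-unique d) (λ {e} h → ∣⇒∈-range1 0<d (⌊⌋-true⁻ (e ∣? d) h) ℕP.≤-refl)
  (range1-unique M) (λ {e} h → ∣⇒∈-range1 0<d (⌊⌋-true⁻ (e ∣? d) h) d≤M)

divisorSum-coprime-part : {p r : ℕ} → Prime p → 0 < r → (f : ℕ → ℤ) →
  ∑ (range1 (p * r)) (λ d → if ⌊ d ∣? p * r ⌋ ∧ not ⌊ p ∣? d ⌋ then f d else 0ℤ) ≡
  ∑ (range1 r) (λ d → if ⌊ d ∣? r ⌋ ∧ not ⌊ p ∣? d ⌋ then f d else 0ℤ)
divisorSum-coprime-part {p} {r} pp 0<r f with prime⇒2+ pp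
... | p' , refl = trans (∑-cong (range1 (p * r)) (λ d → cong (λ b → if b then f d else 0ℤ) (same-condition d)))
  (∑-support ℕ._≟_ P (range1-unique (p * r)) (⊆range1 (ℕP.m≤n*m r p)) (range1-unique r) (⊆range1 ℕP.≤-refl) f)
  where
  P : ℕ → Bool
  P d = ⌊ d ∣? r ⌋ ∧ not ⌊ p ∣? d ⌋
  same-condition : ∀ d → (⌊ d ∣? p * r ⌋ ∧ not ⌊ p ∣? d ⌋) ≡ P d
  same-condition d with p ∣? d
  ... | yes _  = trans (∧-zeroʳ _) (sym (∧-zeroʳ _))
  ... | no p∤d = cong (_∧ true) (≡true-ext
    (λ h → ⌊⌋-true (d ∣? r) (coprime-divisor (prime∤⇒coprime pp p∤d) (⌊⌋-true⁻ (d ∣? p * r) h)))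
    (λ h → ⌊⌋-true (d ∣? p * r) (∣-trans (⌊⌋-true⁻ (d ∣? r) h) (n∣m*n p))))
  ⊆range1 : {M d : ℕ} → r ≤ M → P d ≡ true → d ∈ range1 M
  ⊆range1 {d = d} r≤M h = ∣⇒∈-range1 0<r (⌊⌋-true⁻ (d ∣? r) (∧-conicalˡ _ _ h)) r≤M

divisorSum-multiple-part : {p r : ℕ} → 0 < p → 0 < r → (f : ℕ → ℤ) →
  ∑ (range1 (p * r)) (λ d → if ⌊ d ∣? p * r ⌋ ∧ ⌊ p ∣? d ⌋ then f d else 0ℤ) ≡ divisorSum r (λ c → f (p * c))
divisorSum-multiple-part {p@(suc _)} {r} 0<p 0<r f =
  trans (∑-cong (range1 (p * r)) as-multiple)
        (∑-bijection ℕ._≟_ ℕ._≟_ β (range1-unique (p * r)) ⊆range1-pr (range1-unique r) ⊆range1-r (λ c → f (p * c)))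
  where
  P : ℕ → Bool
  P d = ⌊ d ∣? p * r ⌋ ∧ ⌊ p ∣? d ⌋
  p*[d÷p]≡d : {d : ℕ} → p ∣ d → p * (d ÷ p) ≡ d
  p*[d÷p]≡d {d} p∣d = trans (ℕP.*-comm p (d ÷ p)) (sym (÷-∣ p∣d))
  as-multiple : ∀ d → (if P d then f d else 0ℤ) ≡ (if P d then f (p * (d ÷ p)) else 0ℤ)
  as-multiple d with P d in Pd
  ... | true  = cong f (sym (p*[d÷p]≡d (⌊⌋-true⁻ (p ∣? d) (∧-conicalʳ _ _ Pd))))
  ... | false = refl
  β : SubsetBijection P (λ c → ⌊ c ∣? r ⌋)
  β = record
    { to      = _÷ p
    ; from    = p *_
    ; to-∈    = λ {d} Pd → ⌊⌋-true (d ÷ p ∣? r) (*-cancelˡ-∣ p (subst (_∣ p * r)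
                  (sym (p*[d÷p]≡d (⌊⌋-true⁻ (p ∣? d) (∧-conicalʳ _ _ Pd)))) (⌊⌋-true⁻ (d ∣? p * r) (∧-conicalˡ _ _ Pd))))
    ; from-∈  = λ {c} c∣r → cong₂ _∧_ (⌊⌋-true (p * c ∣? p * r) (*-monoʳ-∣ p (⌊⌋-true⁻ (c ∣? r) c∣r)))
                                       (⌊⌋-true (p ∣? p * c) (m∣m*n c))
    ; from-to = λ {d} Pd → p*[d÷p]≡d (⌊⌋-true⁻ (p ∣? d) (∧-conicalʳ _ _ Pd))
    ; to-from = λ {c} _ → trans (cong (_÷ p) (ℕP.*-comm p c)) (*-÷-cancelʳ c p 0<p)
    }
  ⊆range1-pr : {d : ℕ} → P d ≡ true → d ∈ range1 (p * r)
  ⊆range1-pr {d} Pd = ∣⇒∈-range1 (ℕP.<-≤-trans 0<r (ℕP.m≤n*m r p)) (⌊⌋-true⁻ (d ∣? p * r) (∧-conicalˡ _ _ Pd)) ℕP.≤-refl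
  ⊆range1-r : {c : ℕ} → ⌊ c ∣? r ⌋ ≡ true → c ∈ range1 r
  ⊆range1-r {c} c∣r = ∣⇒∈-range1 0<r (⌊⌋-true⁻ (c ∣? r) c∣r) ℕP.≤-refl

-- The divisors of p r prime to p are those of r; the others are p c with c ∣ r, and μ (p c) is - μ c or 0.
divisorSum-μ-*-prime : {p r : ℕ} → Prime p → 0 < r → divisorSum (p * r) μ ≡ 0ℤ
divisorSum-μ-*-prime {p} {r} pp 0<r with prime⇒2+ pp
... | p' , refl = begin
  divisorSum (p * r) μ
    ≡⟨ ∑-cong (range1 (p * r)) (λ d → if-split ⌊ d ∣? p * r ⌋ ⌊ p ∣? d ⌋ (μ d)) ⟩
  ∑ (range1 (p * r)) (λ d → coprime d ℤ.+ multiple d)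
    ≡⟨ ∑-+ (range1 (p * r)) coprime multiple ⟩
  ∑ (range1 (p * r)) coprime ℤ.+ ∑ (range1 (p * r)) multiple
    ≡⟨ cong₂ ℤ._+_ (divisorSum-coprime-part pp 0<r μ) (divisorSum-multiple-part (s≤s z≤n) 0<r μ) ⟩
  S ℤ.+ divisorSum r (λ c → μ (p * c))
    ≡⟨ cong (λ t → S ℤ.+ t) (trans (∑-cong (range1 r) μ-p*) (∑-neg (range1 r) _)) ⟩
  S ℤ.+ - S
    ≡⟨ ℤP.+-inverseʳ S ⟩
  0ℤ ∎
  where
  open ≡-Reasoning
  coprime multiple : ℕ → ℤ
  coprime  d = if ⌊ d ∣? p * r ⌋ ∧ not ⌊ p ∣? d ⌋ then μ d else 0ℤ
  multiple d = if ⌊ d ∣? p * r ⌋ ∧ ⌊ p ∣? d ⌋ then μ d else 0ℤ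
  S : ℤ
  S = ∑ (range1 r) (λ c → if ⌊ c ∣? r ⌋ ∧ not ⌊ p ∣? c ⌋ then μ c else 0ℤ)
  μ-p* : ∀ c → (if ⌊ c ∣? r ⌋ then μ (p * c) else 0ℤ) ≡ - (if ⌊ c ∣? r ⌋ ∧ not ⌊ p ∣? c ⌋ then μ c else 0ℤ)
  μ-p* c with c ∣? r | p ∣? c
  ... | no _    | _       = refl
  ... | yes c∣r | yes p∣c = μ-*-prime-∣ pp (∣⇒pos 0<r c∣r) p∣c
  ... | yes c∣r | no p∤c  = μ-*-prime-∤ pp (∣⇒pos 0<r c∣r) p∤c

divisorSum-μ : (N : ℕ) → 0 < N → divisorSum N μ ≡ 𝟙 ⌊ N ℕ.≟ 1 ⌋
divisorSum-μ (suc zero)          _ = refl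
divisorSum-μ N@(suc (suc _)) _ with prime-divisor N (s≤s (s≤s z≤n))
... | p , pp , divides r N≡r*p = begin
  divisorSum N μ        ≡⟨ cong (λ n → divisorSum n μ) N≡p*r ⟩
  divisorSum (p * r) μ  ≡⟨ divisorSum-μ-*-prime pp (∣⇒pos (s≤s z≤n) (divides p N≡p*r)) ⟩
  0ℤ                    ∎
  where
  open ≡-Reasoning
  N≡p*r : N ≡ p * r
  N≡p*r = trans N≡r*p (ℕP.*-comm r p)

÷-∣-÷ : {e d M : ℕ} → 0 < M → d ∣ M → e ∣ d → M ÷ d ∣ M ÷ e
÷-∣-÷ {e} {d} {M} 0<M d∣M e∣d = divides (d ÷ e) (begin
  M ÷ e                          ≡⟨ cong (_÷ e) (trans (÷-∣ d∣M) (cong ((M ÷ d) *_) (÷-∣ e∣d))) ⟩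
  ((M ÷ d) * ((d ÷ e) * e)) ÷ e  ≡⟨ cong (_÷ e) (sym (ℕP.*-assoc (M ÷ d) (d ÷ e) e)) ⟩
  ((M ÷ d) * (d ÷ e) * e) ÷ e    ≡⟨ *-÷-cancelʳ _ e (∣⇒pos 0<M (∣-trans e∣d d∣M)) ⟩
  (M ÷ d) * (d ÷ e)              ≡⟨ ℕP.*-comm (M ÷ d) (d ÷ e) ⟩
  (d ÷ e) * (M ÷ d)              ∎)
  where open ≡-Reasoning

∣-÷-÷ : {e c M : ℕ} → 0 < M → e ∣ M → c ∣ M ÷ e → e ∣ M ÷ c
∣-÷-÷ {e} {c} {M} 0<M e∣M c∣q = divides ((M ÷ e) ÷ c) (begin
  M ÷ c                              ≡⟨ cong (_÷ c) (trans (÷-∣ e∣M) (cong (_* e) (÷-∣ c∣q))) ⟩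
  ((M ÷ e) ÷ c * c * e) ÷ c          ≡⟨ cong (_÷ c) (trans (ℕP.*-assoc ((M ÷ e) ÷ c) c e)
                                          (trans (cong ((M ÷ e) ÷ c *_) (ℕP.*-comm c e)) (sym (ℕP.*-assoc ((M ÷ e) ÷ c) e c)))) ⟩
  ((M ÷ e) ÷ c * e * c) ÷ c          ≡⟨ *-÷-cancelʳ _ c (∣⇒pos (∣⇒pos 0<M (÷-∣-self e∣M)) c∣q) ⟩
  (M ÷ e) ÷ c * e                    ∎)
  where open ≡-Reasoning

-- d ↦ M ÷ d maps the divisors of M that are multiples of e onto the divisors of M ÷ e.
∑-μ-cofactor : {M : ℕ} → 0 < M → (e : ℕ) →
  ∑ (range1 M) (λ d → if ⌊ d ∣? M ⌋ ∧ ⌊ e ∣? d ⌋ then μ (M ÷ d) else 0ℤ) ≡ 𝟙 ⌊ e ℕ.≟ M ⌋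
∑-μ-cofactor {M} 0<M e with e ∣? M
... | no e∤M rewrite ⌊⌋-false (e ℕ.≟ M) (λ { refl → e∤M ∣-refl }) =
  trans (∑-cong (range1 M) (λ d → cong (λ b → if b then μ (M ÷ d) else 0ℤ) (no-multiple d))) (∑-0 (range1 M))
  where
  no-multiple : ∀ d → (⌊ d ∣? M ⌋ ∧ ⌊ e ∣? d ⌋) ≡ false
  no-multiple d with d ∣? M | e ∣? d
  ... | yes d∣M | yes e∣d = ⊥-elim (e∤M (∣-trans e∣d d∣M))
  ... | yes _   | no _    = refl
  ... | no _    | _       = refl
... | yes e∣M = begin
  ∑ (range1 M) (λ d → if P d then μ (M ÷ d) else 0ℤ)
    ≡⟨ ∑-bijection ℕ._≟_ ℕ._≟_ β (range1-unique M) ⊆range1-M (range1-unique (M ÷ e)) ⊆range1-M÷e μ ⟩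
  divisorSum (M ÷ e) μ    ≡⟨ divisorSum-μ (M ÷ e) 0<M÷e ⟩
  𝟙 ⌊ M ÷ e ℕ.≟ 1 ⌋      ≡⟨ cong 𝟙 (≡true-ext (⌊⌋-true (e ℕ.≟ M) ∘ M÷e≡1⇒e≡M ∘ ⌊⌋-true⁻ (M ÷ e ℕ.≟ 1))
                                                (⌊⌋-true (M ÷ e ℕ.≟ 1) ∘ e≡M⇒M÷e≡1 ∘ ⌊⌋-true⁻ (e ℕ.≟ M))) ⟩
  𝟙 ⌊ e ℕ.≟ M ⌋          ∎
  where
  open ≡-Reasoning
  0<M÷e : 0 < M ÷ e
  0<M÷e = ∣⇒pos 0<M (÷-∣-self e∣M)
  M÷e≡1⇒e≡M : M ÷ e ≡ 1 → e ≡ M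
  M÷e≡1⇒e≡M M÷e≡1 = sym (trans (÷-∣ e∣M) (trans (cong (_* e) M÷e≡1) (ℕP.*-identityˡ e)))
  e≡M⇒M÷e≡1 : e ≡ M → M ÷ e ≡ 1
  e≡M⇒M÷e≡1 refl = ℕP.*-cancelʳ-≡ (M ÷ e) 1 e {{ℕ.>-nonZero 0<M}} (trans (sym (÷-∣ e∣M)) (sym (ℕP.*-identityˡ e)))
  P : ℕ → Bool
  P d = ⌊ d ∣? M ⌋ ∧ ⌊ e ∣? d ⌋
  β : SubsetBijection P (λ c → ⌊ c ∣? M ÷ e ⌋)
  β = record
    { to      = M ÷_
    ; from    = M ÷_
    ; to-∈    = λ {d} Pd → ⌊⌋-true (M ÷ d ∣? M ÷ e)
                  (÷-∣-÷ 0<M (⌊⌋-true⁻ (d ∣? M) (∧-conicalˡ _ _ Pd)) (⌊⌋-true⁻ (e ∣? d) (∧-conicalʳ _ _ Pd)))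
    ; from-∈  = λ {c} c∣M÷e → cong₂ _∧_
                  (⌊⌋-true (M ÷ c ∣? M) (÷-∣-self (∣-trans (⌊⌋-true⁻ (c ∣? M ÷ e) c∣M÷e) (÷-∣-self e∣M))))
                  (⌊⌋-true (e ∣? M ÷ c) (∣-÷-÷ 0<M e∣M (⌊⌋-true⁻ (c ∣? M ÷ e) c∣M÷e)))
    ; from-to = λ {d} Pd → ÷-involutive 0<M (⌊⌋-true⁻ (d ∣? M) (∧-conicalˡ _ _ Pd))
    ; to-from = λ {c} c∣M÷e → ÷-involutive 0<M (∣-trans (⌊⌋-true⁻ (c ∣? M ÷ e) c∣M÷e) (÷-∣-self e∣M))
    }
  ⊆range1-M : {d : ℕ} → P d ≡ true → d ∈ range1 M
  ⊆range1-M {d} Pd = ∣⇒∈-range1 0<M (⌊⌋-true⁻ (d ∣? M) (∧-conicalˡ _ _ Pd)) ℕP.≤-refl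
  ⊆range1-M÷e : {c : ℕ} → ⌊ c ∣? M ÷ e ⌋ ≡ true → c ∈ range1 (M ÷ e)
  ⊆range1-M÷e {c} c∣M÷e = ∣⇒∈-range1 0<M÷e (⌊⌋-true⁻ (c ∣? M ÷ e) c∣M÷e) ℕP.≤-refl

μ-*-divisorSum-as-∑ : {M d : ℕ} → 0 < M → (f : ℕ → ℤ) →
  (if ⌊ d ∣? M ⌋ then μ (M ÷ d) ℤ.* divisorSum d f else 0ℤ)
    ≡ ∑ (range1 M) (λ e → if ⌊ d ∣? M ⌋ ∧ ⌊ e ∣? d ⌋ then μ (M ÷ d) ℤ.* f e else 0ℤ)
μ-*-divisorSum-as-∑ {M} {d} 0<M f with d ∣? M
... | no _    = sym (∑-0 (range1 M))
... | yes d∣M = begin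
  μ (M ÷ d) ℤ.* divisorSum d f
    ≡⟨ cong (μ (M ÷ d) ℤ.*_) (divisorSum-as-∑ (∣⇒pos 0<M d∣M) (∣⇒≤ {{ℕ.>-nonZero 0<M}} d∣M) f) ⟩
  μ (M ÷ d) ℤ.* ∑ (range1 M) (λ e → if ⌊ e ∣? d ⌋ then f e else 0ℤ)
    ≡⟨ sym (∑-*ˡ (range1 M) (μ (M ÷ d)) _) ⟩
  ∑ (range1 M) (λ e → μ (M ÷ d) ℤ.* (if ⌊ e ∣? d ⌋ then f e else 0ℤ))
    ≡⟨ ∑-cong (range1 M) (λ e → *-if (μ (M ÷ d)) ⌊ e ∣? d ⌋ (f e)) ⟩
  ∑ (range1 M) (λ e → if ⌊ e ∣? d ⌋ then μ (M ÷ d) ℤ.* f e else 0ℤ) ∎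
  where open ≡-Reasoning

∑-μ-cofactor-* : {M : ℕ} → 0 < M → (f : ℕ → ℤ) (e : ℕ) →
  ∑ (range1 M) (λ d → if ⌊ d ∣? M ⌋ ∧ ⌊ e ∣? d ⌋ then μ (M ÷ d) ℤ.* f e else 0ℤ) ≡ (if ⌊ e ℕ.≟ M ⌋ then f e else 0ℤ)
∑-μ-cofactor-* {M} 0<M f e = begin
  ∑ (range1 M) (λ d → if ⌊ d ∣? M ⌋ ∧ ⌊ e ∣? d ⌋ then μ (M ÷ d) ℤ.* f e else 0ℤ)
    ≡⟨ ∑-cong (range1 M) (λ d → sym (if-* (⌊ d ∣? M ⌋ ∧ ⌊ e ∣? d ⌋) (μ (M ÷ d)) (f e))) ⟩
  ∑ (range1 M) (λ d → (if ⌊ d ∣? M ⌋ ∧ ⌊ e ∣? d ⌋ then μ (M ÷ d) else 0ℤ) ℤ.* f e)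
    ≡⟨ ∑-*ʳ (range1 M) (f e) _ ⟩
  ∑ (range1 M) (λ d → if ⌊ d ∣? M ⌋ ∧ ⌊ e ∣? d ⌋ then μ (M ÷ d) else 0ℤ) ℤ.* f e
    ≡⟨ cong (ℤ._* f e) (∑-μ-cofactor 0<M e) ⟩
  𝟙 ⌊ e ℕ.≟ M ⌋ ℤ.* f e
    ≡⟨ 𝟙-* ⌊ e ℕ.≟ M ⌋ (f e) ⟩
  (if ⌊ e ℕ.≟ M ⌋ then f e else 0ℤ) ∎
  where open ≡-Reasoning

möbius-inversion : (f g : ℕ → ℤ) → (∀ {N} → 0 < N → divisorSum N f ≡ g N) →
  {M : ℕ} → 0 < M → divisorSum M (λ d → μ (M ÷ d) ℤ.* g d) ≡ f M
möbius-inversion f g f⇒g {M} 0<M = begin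
  divisorSum M (λ d → μ (M ÷ d) ℤ.* g d)
    ≡⟨ divisorSum-cong M (λ {d} d∣M → cong (μ (M ÷ d) ℤ.*_) (sym (f⇒g (∣⇒pos 0<M d∣M)))) ⟩
  divisorSum M (λ d → μ (M ÷ d) ℤ.* divisorSum d f)
    ≡⟨ ∑-cong (range1 M) (λ d → μ-*-divisorSum-as-∑ {d = d} 0<M f) ⟩
  ∑ (range1 M) (λ d → ∑ (range1 M) (T d))
    ≡⟨ ∑-swap (range1 M) (range1 M) T ⟩
  ∑ (range1 M) (λ e → ∑ (range1 M) (λ d → T d e))
    ≡⟨ ∑-cong (range1 M) (∑-μ-cofactor-* 0<M f) ⟩
  ∑ (range1 M) (λ e → if ⌊ e ℕ.≟ M ⌋ then f e else 0ℤ)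
    ≡⟨ ∑-pick ℕ._≟_ f (range1-unique M) (∈-range1 0<M ℕP.≤-refl) ⟩
  f M ∎
  where
  open ≡-Reasoning
  T : ℕ → ℕ → ℤ
  T d e = if ⌊ d ∣? M ⌋ ∧ ⌊ e ∣? d ⌋ then μ (M ÷ d) ℤ.* f e else 0ℤ

-- Lexicographic order

record LawfulCmp {A : Set} (c : A → A → Cmp) : Set where
  field
    eq⇒≡     : ∀ {x y} → c x y ≡ eq → x ≡ y
    eq-refl  : ∀ x → c x x ≡ eq
    lt⇒gt    : ∀ {x y} → c x y ≡ lt → c y x ≡ gt
    gt⇒lt    : ∀ {x y} → c x y ≡ gt → c y x ≡ lt
    lt-trans : ∀ {x y z} → c x y ≡ lt → c y z ≡ lt → c x z ≡ lt

cmpℕ-lawful : LawfulCmp cmpℕ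
cmpℕ-lawful = record
  { eq⇒≡     = λ {x} {y} → eq⇒≡ {x} {y}
  ; eq-refl  = eq-refl
  ; lt⇒gt    = λ {x} {y} → lt⇒gt {x} {y}
  ; gt⇒lt    = λ {x} {y} → gt⇒lt {x} {y}
  ; lt-trans = λ {x} {y} {z} → lt-trans {x} {y} {z}
  }
  where
  eq⇒≡ : ∀ {x y} → cmpℕ x y ≡ eq → x ≡ y
  eq⇒≡ {zero}  {zero}  _ = refl
  eq⇒≡ {suc x} {suc y} h = cong suc (eq⇒≡ {x} {y} h)
  eq-refl : ∀ x → cmpℕ x x ≡ eq
  eq-refl zero    = refl
  eq-refl (suc x) = eq-refl x
  lt⇒gt : ∀ {x y} → cmpℕ x y ≡ lt → cmpℕ y x ≡ gt
  lt⇒gt {zero}  {suc y} _ = refl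
  lt⇒gt {suc x} {suc y} h = lt⇒gt {x} {y} h
  gt⇒lt : ∀ {x y} → cmpℕ x y ≡ gt → cmpℕ y x ≡ lt
  gt⇒lt {suc x} {zero}  _ = refl
  gt⇒lt {suc x} {suc y} h = gt⇒lt {x} {y} h
  lt-trans : ∀ {x y z} → cmpℕ x y ≡ lt → cmpℕ y z ≡ lt → cmpℕ x z ≡ lt
  lt-trans {zero}  {suc y} {suc z} _  _  = refl
  lt-trans {suc x} {suc y} {suc z} h₁ h₂ = lt-trans {x} {y} {z} h₁ h₂

cmpΣ-lawful : {k : ℕ} → LawfulCmp (cmpΣ {k})
cmpΣ-lawful = record
  { eq⇒≡     = λ {x} {y} h → FinP.toℕ-injective (eq⇒≡ {toℕ x} {toℕ y} h)
  ; eq-refl  = λ x → eq-refl (toℕ x)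
  ; lt⇒gt    = λ {x} {y} → lt⇒gt {toℕ x} {toℕ y}
  ; gt⇒lt    = λ {x} {y} → gt⇒lt {toℕ x} {toℕ y}
  ; lt-trans = λ {x} {y} {z} → lt-trans {toℕ x} {toℕ y} {toℕ z}
  }
  where open LawfulCmp cmpℕ-lawful

cmpLex-lawful : {A : Set} {c : A → A → Cmp} → LawfulCmp c → (n : ℕ) → LawfulCmp (cmpLex {A} {n} c)
cmpLex-lawful {A} {c} law n = record
  { eq⇒≡     = λ {xs} {ys} → eq⇒≡ {n} {xs} {ys}
  ; eq-refl  = eq-refl
  ; lt⇒gt    = λ {xs} {ys} → lt⇒gt {n} {xs} {ys}
  ; gt⇒lt    = λ {xs} {ys} → gt⇒lt {n} {xs} {ys}
  ; lt-trans = λ {xs} {ys} {zs} → lt-trans {n} {xs} {ys} {zs}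
  }
  where
  module C = LawfulCmp law
  eq⇒≡ : ∀ {m} {xs ys : Vec A m} → cmpLex c xs ys ≡ eq → xs ≡ ys
  eq⇒≡ {xs = []}     {[]}     _ = refl
  eq⇒≡ {xs = x ∷ xs} {y ∷ ys} h with c x y in cxy
  ... | eq = cong₂ _∷_ (C.eq⇒≡ cxy) (eq⇒≡ {xs = xs} {ys} h)
  eq-refl : ∀ {m} (xs : Vec A m) → cmpLex c xs xs ≡ eq
  eq-refl []       = refl
  eq-refl (x ∷ xs) rewrite C.eq-refl x = eq-refl xs
  lt⇒gt : ∀ {m} {xs ys : Vec A m} → cmpLex c xs ys ≡ lt → cmpLex c ys xs ≡ gt
  lt⇒gt {xs = []}     {[]}     ()
  lt⇒gt {xs = x ∷ xs} {y ∷ ys} h with c x y in cxy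
  ... | lt rewrite C.lt⇒gt cxy = refl
  ... | eq with refl ← C.eq⇒≡ cxy rewrite C.eq-refl x = lt⇒gt {xs = xs} {ys} h
  gt⇒lt : ∀ {m} {xs ys : Vec A m} → cmpLex c xs ys ≡ gt → cmpLex c ys xs ≡ lt
  gt⇒lt {xs = []}     {[]}     ()
  gt⇒lt {xs = x ∷ xs} {y ∷ ys} h with c x y in cxy
  ... | gt rewrite C.gt⇒lt cxy = refl
  ... | eq with refl ← C.eq⇒≡ cxy rewrite C.eq-refl x = gt⇒lt {xs = xs} {ys} h
  lt-trans : ∀ {m} {xs ys zs : Vec A m} → cmpLex c xs ys ≡ lt → cmpLex c ys zs ≡ lt → cmpLex c xs zs ≡ lt
  lt-trans {xs = []}     {[]}     {[]}     ()
  lt-trans {xs = x ∷ xs} {y ∷ ys} {z ∷ zs} h₁ h₂ with c x y in cxy | c y z in cyz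
  ... | lt | lt rewrite C.lt-trans cxy cyz = refl
  ... | lt | eq with refl ← C.eq⇒≡ cyz rewrite cxy = refl
  ... | eq | lt with refl ← C.eq⇒≡ cxy rewrite cyz = refl
  ... | eq | eq with refl ← C.eq⇒≡ cxy | refl ← C.eq⇒≡ cyz rewrite C.eq-refl x = lt-trans {xs = xs} {ys} {zs} h₁ h₂

cmpPat-lawful : (k m n : ℕ) → LawfulCmp (cmpPat {k} {m} {n})
cmpPat-lawful k m n = cmpLex-lawful (cmpLex-lawful cmpΣ-lawful n) m

module CmpOrder {A : Set} {c : A → A → Cmp} (law : LawfulCmp c) where

  open LawfulCmp law

  record _≺_ (x y : A) : Set where
    constructor mk≺
    field c≡lt : c x y ≡ lt

  _≼_ : A → A → Set
  x ≼ y = ¬ y ≺ x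

  ≺-irrefl : ∀ {x} → ¬ x ≺ x
  ≺-irrefl {x} (mk≺ h) with () ← trans (sym h) (eq-refl x)

  ≺-asym : ∀ {x y} → x ≺ y → ¬ y ≺ x
  ≺-asym (mk≺ h₁) (mk≺ h₂) with () ← trans (sym (lt⇒gt h₁)) h₂

  ≺-trans : ∀ {x y z} → x ≺ y → y ≺ z → x ≺ z
  ≺-trans (mk≺ h₁) (mk≺ h₂) = mk≺ (lt-trans h₁ h₂)

  ≼-refl : ∀ {x} → x ≼ x
  ≼-refl = ≺-irrefl

  ≺⇒≼ : ∀ {x y} → x ≺ y → x ≼ y
  ≺⇒≼ = ≺-asym

  ≼-trans : ∀ {x y z} → x ≼ y → y ≼ z → x ≼ z
  ≼-trans {x} {y} {z} y⊀x z⊀y z≺x with c z y in h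
  ... | lt = z⊀y (mk≺ h)
  ... | eq with refl ← eq⇒≡ h = y⊀x z≺x
  ... | gt = y⊀x (≺-trans (mk≺ (gt⇒lt h)) z≺x)

  ⊀∧⊁⇒≡ : ∀ {x y} → ¬ x ≺ y → ¬ y ≺ x → x ≡ y
  ⊀∧⊁⇒≡ {x} {y} x⊀y y⊀x with c x y in h
  ... | lt = ⊥-elim (x⊀y (mk≺ h))
  ... | eq = eq⇒≡ h
  ... | gt = ⊥-elim (y⊀x (mk≺ (gt⇒lt h)))

  ≼-antisym : ∀ {x y} → x ≼ y → y ≼ x → x ≡ y
  ≼-antisym x≼y y≼x = ⊀∧⊁⇒≡ y≼x x≼y

  ≼∧≢⇒≺ : ∀ {x y} → x ≼ y → x ≢ y → x ≺ y
  ≼∧≢⇒≺ {x} {y} x≼y x≢y with c x y in h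
  ... | lt = mk≺ h
  ... | eq = ⊥-elim (x≢y (eq⇒≡ h))
  ... | gt = ⊥-elim (x≼y (mk≺ (gt⇒lt h)))

  isLt⇒≺ : ∀ {x y} → isLt (c x y) ≡ true → x ≺ y
  isLt⇒≺ {x} {y} h with c x y in cxy
  ... | lt = mk≺ cxy

  ≺⇒isLt : ∀ {x y} → x ≺ y → isLt (c x y) ≡ true
  ≺⇒isLt (mk≺ h) rewrite h = refl

  ¬isLt⇒⊀ : ∀ {x y} → isLt (c x y) ≡ false → ¬ x ≺ y
  ¬isLt⇒⊀ h (mk≺ cxy) rewrite cxy with () ← h

  minimum : (q : A → Bool) (xs : List A) →
    (∀ {y} → y ∈ xs → q y ≡ false) ⊎ ∃[ a ] (q a ≡ true × ∀ {y} → y ∈ xs → q y ≡ true → a ≼ y)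
  minimum q [] = inj₁ (λ ())
  minimum q (x ∷ xs) with minimum q xs | q x in qx
  ... | inj₁ none | false = inj₁ (λ { (here refl) → qx ; (there y∈xs) → none y∈xs })
  ... | inj₁ none | true  = inj₂ (x , qx , λ { (here refl) _ → ≼-refl
                                              ; (there y∈xs) qy → ⊥-elim (false≢true (trans (sym (none y∈xs)) qy)) })
  ... | inj₂ (b , qb , b-min) | false = inj₂ (b , qb , λ { (here refl) qy → ⊥-elim (false≢true (trans (sym qx) qy))
                                                         ; (there y∈xs) → b-min y∈xs })
  ... | inj₂ (b , qb , b-min) | true with isLt (c x b) in x≺b
  ...   | true  = inj₂ (x , qx , λ { (here refl) _ → ≼-refl
                                   ; (there y∈xs) qy → ≼-trans (≺⇒≼ (isLt⇒≺ x≺b)) (b-min y∈xs qy) })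
  ...   | false = inj₂ (b , qb , λ { (here refl) _ → ¬isLt⇒⊀ x≺b ; (there y∈xs) → b-min y∈xs })

  minimum-∃ : (q : A → Bool) (xs : List A) {a : A} → a ∈ xs → q a ≡ true →
    ∃[ b ] (q b ≡ true × ∀ {y} → y ∈ xs → q y ≡ true → b ≼ y)
  minimum-∃ q xs a∈xs qa with minimum q xs
  ... | inj₁ none = ⊥-elim (false≢true (trans (sym (none a∈xs)) qa))
  ... | inj₂ least = least

-- Cyclic rotations and periods

module _ {A : Set} where

  lookupℕ : {M : ℕ} → Vec A M → (i : ℕ) → .(i < M) → A
  lookupℕ w i i<M = lookup w (fromℕ< i<M)

  lookupℕ-cong : {M : ℕ} (w : Vec A M) {i j : ℕ} .{i<M : i < M} .{j<M : j < M} → i ≡ j → lookupℕ w i i<M ≡ lookupℕ w j j<M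
  lookupℕ-cong w refl = refl

  lookupℕ-∷ʳ-< : {m : ℕ} (xs : Vec A m) (x : A) {i : ℕ} .(i<1+m : i < suc m) .(i<m : i < m) →
    lookupℕ (xs ∷ʳ x) i i<1+m ≡ lookupℕ xs i i<m
  lookupℕ-∷ʳ-< (y ∷ ys) x {zero}  _ _ = refl
  lookupℕ-∷ʳ-< (y ∷ ys) x {suc i} p q = lookupℕ-∷ʳ-< ys x (ℕP.≤-pred p) (ℕP.≤-pred q)

  lookupℕ-∷ʳ-last : {m : ℕ} (xs : Vec A m) (x : A) .(m<1+m : m < suc m) → lookupℕ (xs ∷ʳ x) m m<1+m ≡ x
  lookupℕ-∷ʳ-last []       x _ = refl
  lookupℕ-∷ʳ-last (y ∷ ys) x p = lookupℕ-∷ʳ-last ys x (ℕP.≤-pred p)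

  at : {m : ℕ} → Vec A (suc m) → ℕ → A
  at {m} w j = lookupℕ w (j % suc m) (m%n<n j (suc m))

  at-cong-mod : {m : ℕ} (w : Vec A (suc m)) (i j : ℕ) → i % suc m ≡ j % suc m → at w i ≡ at w j
  at-cong-mod w i j = lookupℕ-cong w

  at-< : {m : ℕ} (w : Vec A (suc m)) {i : ℕ} (i<M : i < suc m) → at w i ≡ lookupℕ w i i<M
  at-< w i<M = lookupℕ-cong w (m<n⇒m%n≡m i<M)

  at-mod : {m : ℕ} (w : Vec A (suc m)) (j : ℕ) → at w (j % suc m) ≡ at w j
  at-mod {m} w j = at-cong-mod w (j % suc m) j (m%n%n≡m%n j (suc m))

  at-ext : {m : ℕ} (w v : Vec A (suc m)) → (∀ j → at w j ≡ at v j) → w ≡ v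
  at-ext w v w≗v = begin
    w                     ≡⟨ sym (VecP.tabulate∘lookup w) ⟩
    tabulate (lookup w)   ≡⟨ VecP.tabulate-cong (λ i → trans (sym (at-lookup w i)) (trans (w≗v (toℕ i)) (at-lookup v i))) ⟩
    tabulate (lookup v)   ≡⟨ VecP.tabulate∘lookup v ⟩
    v                     ∎
    where
    open ≡-Reasoning
    at-lookup : {m : ℕ} (u : Vec A (suc m)) (i : Fin (suc m)) → at u (toℕ i) ≡ lookup u i
    at-lookup u i = trans (at-< u (FinP.toℕ<n i)) (cong (lookup u) (FinP.fromℕ<-toℕ i _))

  at-rot1 : {m : ℕ} (w : Vec A (suc m)) (j : ℕ) → at (rot1 w) j ≡ at w (suc j)
  at-rot1 {m} (x ∷ xs) j with ℕP.<-cmp (j % suc m) m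
  ... | tri< j%M<m _ _ = begin
    at (xs ∷ʳ x) j                       ≡⟨ lookupℕ-∷ʳ-< xs x (m%n<n j (suc m)) j%M<m ⟩
    lookupℕ (x ∷ xs) (suc (j % suc m)) (s≤s j%M<m)  ≡⟨ sym (at-< (x ∷ xs) (s≤s j%M<m)) ⟩
    at (x ∷ xs) (suc (j % suc m))        ≡⟨ at-cong-mod (x ∷ xs) (suc (j % suc m)) (suc j) (sym (suc-mod j)) ⟩
    at (x ∷ xs) (suc j)                  ∎
    where
    open ≡-Reasoning
    suc-mod : ∀ i → suc i % suc m ≡ suc (i % suc m) % suc m
    suc-mod i = trans (cong (λ t → suc t % suc m) (m≡m%n+[m/n]*n i (suc m))) ([m+kn]%n≡m%n (suc (i % suc m)) (i / suc m) (suc m))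
  ... | tri≈ _ j%M≡m _ = begin
    at (xs ∷ʳ x) j                       ≡⟨ lookupℕ-cong (xs ∷ʳ x) {j<M = ℕP.n<1+n m} j%M≡m ⟩
    lookupℕ (xs ∷ʳ x) m (ℕP.n<1+n m)     ≡⟨ lookupℕ-∷ʳ-last xs x _ ⟩
    at (x ∷ xs) 0                        ≡⟨ at-cong-mod (x ∷ xs) 0 (suc j) (sym 1+j%M≡0) ⟩
    at (x ∷ xs) (suc j)                  ∎
    where
    open ≡-Reasoning
    1+j%M≡0 : suc j % suc m ≡ 0 % suc m
    1+j%M≡0 = begin
      suc j % suc m                                   ≡⟨ cong (λ t → suc t % suc m) (m≡m%n+[m/n]*n j (suc m)) ⟩
      (suc (j % suc m) + (j / suc m) * suc m) % suc m ≡⟨ [m+kn]%n≡m%n (suc (j % suc m)) (j / suc m) (suc m) ⟩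
      suc (j % suc m) % suc m                         ≡⟨ cong (λ t → suc t % suc m) j%M≡m ⟩
      suc m % suc m                                   ≡⟨ n%n≡0 (suc m) ⟩
      0                                               ∎
  ... | tri> _ _ m<j%M = ⊥-elim (ℕP.<-irrefl refl (ℕP.≤-trans (m%n<n j (suc m)) m<j%M))

  at-rot : {m : ℕ} (e : ℕ) (w : Vec A (suc m)) (j : ℕ) → at (rot e w) j ≡ at w (j + e)
  at-rot zero    w j = cong (at w) (sym (ℕP.+-identityʳ j))
  at-rot (suc e) w j = trans (at-rot e (rot1 w) j) (trans (at-rot1 w (j + e)) (cong (at w) (sym (ℕP.+-suc j e))))

  rot-+ : {m : ℕ} (a b : ℕ) (w : Vec A m) → rot a (rot b w) ≡ rot (b + a) w
  rot-+ a zero    w = refl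
  rot-+ a (suc b) w = rot-+ a b (rot1 w)

  rot-comm : {m : ℕ} (a b : ℕ) (w : Vec A m) → rot a (rot b w) ≡ rot b (rot a w)
  rot-comm a b w = trans (rot-+ a b w) (trans (cong (λ t → rot t w) (ℕP.+-comm b a)) (sym (rot-+ b a w)))

  rot-cong-mod : {m : ℕ} (a b : ℕ) (w : Vec A (suc m)) → a % suc m ≡ b % suc m → rot a w ≡ rot b w
  rot-cong-mod {m} a b w a≡b = at-ext (rot a w) (rot b w) (λ j → begin
    at (rot a w) j  ≡⟨ at-rot a w j ⟩
    at w (j + a)    ≡⟨ at-cong-mod w (j + a) (j + b) (begin
                         (j + a) % suc m                    ≡⟨ %-distribˡ-+ j a (suc m) ⟩
                         (j % suc m + a % suc m) % suc m    ≡⟨ cong (λ t → (j % suc m + t) % suc m) a≡b ⟩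
                         (j % suc m + b % suc m) % suc m    ≡⟨ sym (%-distribˡ-+ j b (suc m)) ⟩
                         (j + b) % suc m                    ∎) ⟩
    at w (j + b)    ≡⟨ sym (at-rot b w j) ⟩
    at (rot b w) j  ∎)
    where open ≡-Reasoning

  rot-mod : {m : ℕ} (a : ℕ) (w : Vec A (suc m)) → rot (a % suc m) w ≡ rot a w
  rot-mod {m} a w = rot-cong-mod (a % suc m) a w (m%n%n≡m%n a (suc m))

  rot-length : {m : ℕ} (w : Vec A (suc m)) → rot (suc m) w ≡ w
  rot-length {m} w = rot-cong-mod (suc m) 0 w (n%n≡0 (suc m))

  rot-injective : {m : ℕ} (e : ℕ) {w v : Vec A (suc m)} → rot e w ≡ rot e v → w ≡ v
  rot-injective {m} e {w} {v} rotated≡ = trans (sym (undo w)) (trans (cong (rot (e * m)) rotated≡) (undo v))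
    where
    undo : (u : Vec A (suc m)) → rot (e * m) (rot e u) ≡ u
    undo u = trans (rot-+ (e * m) e u)
      (trans (cong (λ t → rot t u) (sym (ℕP.*-suc e m))) (rot-cong-mod (e * suc m) 0 u (m*n%n≡0 e (suc m))))

  rot-map : {B : Set} {m : ℕ} (f : A → B) (j : ℕ) (w : Vec A m) → rot j (Vec.map f w) ≡ Vec.map f (rot j w)
  rot-map f zero    w        = refl
  rot-map f (suc j) []       = rot-map f j []
  rot-map f (suc j) (x ∷ xs) = trans (cong (rot j) (sym (VecP.map-∷ʳ f x xs))) (rot-map f j (xs ∷ʳ x))

  resize : {a : ℕ} (b : ℕ) → Vec A (suc a) → Vec A (suc b)
  resize b w = tabulate (λ i → at w (toℕ i))

  at-resize : {a : ℕ} (b : ℕ) (w : Vec A (suc a)) (j : ℕ) → at (resize b w) j ≡ at w (j % suc b)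
  at-resize b w j = trans (VecP.lookup∘tabulate (λ i → at w (toℕ i)) (fromℕ< (m%n<n j (suc b))))
                          (cong (at w) (FinP.toℕ-fromℕ< (m%n<n j (suc b))))

  at-periodic : {m : ℕ} (d : ℕ) .{{_ : ℕ.NonZero d}} (w : Vec A (suc m)) → rot d w ≡ w → ∀ j → at w j ≡ at w (j % d)
  at-periodic d w rot-d≡w j = trans (cong (at w) (m≡m%n+[m/n]*n j d)) (shift (j % d) (j / d))
    where
    shift : ∀ r q → at w (r + q * d) ≡ at w r
    shift r zero    = cong (at w) (ℕP.+-identityʳ r)
    shift r (suc q) = begin
      at w (r + (d + q * d))   ≡⟨ cong (at w) (trans (cong (λ t → r + t) (ℕP.+-comm d (q * d))) (sym (ℕP.+-assoc r (q * d) d))) ⟩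
      at w (r + q * d + d)     ≡⟨ sym (at-rot d w (r + q * d)) ⟩
      at (rot d w) (r + q * d) ≡⟨ cong (λ u → at u (r + q * d)) rot-d≡w ⟩
      at w (r + q * d)         ≡⟨ shift r q ⟩
      at w r                   ∎
      where open ≡-Reasoning

firstTrue : (ℕ → Bool) → ℕ → ℕ
firstTrue P zero    = zero
firstTrue P (suc n) = if P zero then zero else suc (firstTrue (P ∘ suc) n)

firstTrue-≤ : (P : ℕ → Bool) (n : ℕ) → firstTrue P n ≤ n
firstTrue-≤ P zero    = z≤n
firstTrue-≤ P (suc n) with P zero
... | true  = z≤n
... | false = s≤s (firstTrue-≤ (P ∘ suc) n)

firstTrue-minimal : (P : ℕ → Bool) (n : ℕ) {i : ℕ} → i < firstTrue P n → P i ≡ false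
firstTrue-minimal P (suc n) {i} i< with P zero in P0
firstTrue-minimal P (suc n) {zero}  i<       | false = P0
firstTrue-minimal P (suc n) {suc i} (s≤s i<) | false = firstTrue-minimal (P ∘ suc) n i<

firstTrue-true : (P : ℕ → Bool) (n : ℕ) → firstTrue P n < n → P (firstTrue P n) ≡ true
firstTrue-true P (suc n) found with P zero in P0
... | true  = P0
... | false = firstTrue-true (P ∘ suc) n (ℕP.≤-pred found)

record IsLeastPeriod {A : Set} {m : ℕ} (w : Vec A (suc m)) (d : ℕ) : Set where
  field
    positive : 0 < d
    fixes    : rot d w ≡ w
    least    : ∀ {e} → 0 < e → e < d → rot e w ≢ w

module _ {A : Set} {m : ℕ} {w : Vec A (suc m)} where

  leastPeriod-unique : {d d' : ℕ} → IsLeastPeriod w d → IsLeastPeriod w d' → d ≡ d'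
  leastPeriod-unique {d} {d'} p p' with ℕP.<-cmp d d'
  ... | tri< d<d' _ _ = ⊥-elim (IsLeastPeriod.least p' (IsLeastPeriod.positive p) d<d' (IsLeastPeriod.fixes p))
  ... | tri≈ _ d≡d' _ = d≡d'
  ... | tri> _ _ d'<d = ⊥-elim (IsLeastPeriod.least p (IsLeastPeriod.positive p') d'<d (IsLeastPeriod.fixes p'))

  rot-*-period : {d : ℕ} → rot d w ≡ w → ∀ q → rot (q * d) w ≡ w
  rot-*-period rot-d zero    = refl
  rot-*-period {d} rot-d (suc q) = trans (sym (rot-+ (q * d) d w)) (trans (cong (rot (q * d)) rot-d) (rot-*-period rot-d q))

  leastPeriod-∣ : {d : ℕ} → IsLeastPeriod w d → d ∣ suc m
  leastPeriod-∣ {d@(suc _)} p = m%n≡0⇒n∣m (suc m) d (remainder≡0 (suc m % d) refl)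
    where
    rot-remainder : rot (suc m % d) w ≡ w
    rot-remainder = begin
      rot (suc m % d) w                     ≡⟨ cong (rot (suc m % d)) (sym (rot-*-period (IsLeastPeriod.fixes p) (suc m / d))) ⟩
      rot (suc m % d) (rot (suc m / d * d) w) ≡⟨ rot-+ (suc m % d) (suc m / d * d) w ⟩
      rot (suc m / d * d + suc m % d) w
        ≡⟨ cong (λ t → rot t w) (trans (ℕP.+-comm (suc m / d * d) _) (sym (m≡m%n+[m/n]*n (suc m) d))) ⟩
      rot (suc m) w                         ≡⟨ rot-length w ⟩
      w                                     ∎
      where open ≡-Reasoning
    remainder≡0 : ∀ r → suc m % d ≡ r → r ≡ 0
    remainder≡0 zero    _  = refl
    remainder≡0 (suc r) M%d≡r = ⊥-elim (IsLeastPeriod.least p (s≤s z≤n) (subst (_< d) M%d≡r (m%n<n (suc m) d))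
                                                              (subst (λ t → rot t w ≡ w) M%d≡r rot-remainder))

period : {A : Set} → DecidableEquality A → {m : ℕ} → Vec A (suc m) → ℕ
period _≟_ {m} w = suc (firstTrue (λ e → ⌊ VecP.≡-dec _≟_ (rot (suc e) w) w ⌋) m)

period-isLeast : {A : Set} (_≟_ : DecidableEquality A) {m : ℕ} (w : Vec A (suc m)) → IsLeastPeriod w (period _≟_ w)
period-isLeast _≟_ {m} w = record
  { positive = s≤s z≤n
  ; fixes    = fixes
  ; least    = λ { {suc e} _ (s≤s e<i₀) → ⌊⌋-false⁻ (VecP.≡-dec _≟_ (rot (suc e) w) w) (firstTrue-minimal P m e<i₀) }
  }
  where
  P : ℕ → Bool
  P e = ⌊ VecP.≡-dec _≟_ (rot (suc e) w) w ⌋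
  i₀ : ℕ
  i₀ = firstTrue P m
  fixes : rot (suc i₀) w ≡ w
  fixes with ℕP.m≤n⇒m<n∨m≡n (firstTrue-≤ P m)
  ... | inj₁ i₀<m = ⌊⌋-true⁻ (VecP.≡-dec _≟_ (rot (suc i₀) w) w) (firstTrue-true P m i₀<m)
  ... | inj₂ i₀≡m = subst (λ t → rot (suc t) w ≡ w) (sym i₀≡m) (rot-length w)

period-∣ : {A : Set} (_≟_ : DecidableEquality A) {m : ℕ} (w : Vec A (suc m)) → period _≟_ w ∣ suc m
period-∣ _≟_ w = leastPeriod-∣ (period-isLeast _≟_ w)

module _ {A : Set} {m : ℕ} where

  primitive-rot : {w : Vec A (suc m)} → IsLeastPeriod w (suc m) → (i : ℕ) → IsLeastPeriod (rot i w) (suc m)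
  primitive-rot {w} prim i = record
    { positive = s≤s z≤n
    ; fixes    = rot-length (rot i w)
    ; least    = λ {e} 0<e e<M rot-e≡ → IsLeastPeriod.least prim 0<e e<M
                   (rot-injective i (trans (rot-comm i e w) rot-e≡))
    }

  primitive-rot-injective : {w : Vec A (suc m)} → IsLeastPeriod w (suc m) →
    {i j : ℕ} → i < suc m → j < suc m → rot i w ≡ rot j w → i ≡ j
  primitive-rot-injective {w} prim {i} {j} i<M j<M rot≡ with ℕP.<-cmp i j
  ... | tri< i<j _ _ = ⊥-elim (no-shift i<j j<M rot≡)
    where
    no-shift : {a b : ℕ} → a < b → b < suc m → rot a w ≢ rot b w
    no-shift {a} {b} a<b b<M rot≡' = IsLeastPeriod.least (primitive-rot prim a) (ℕP.m<n⇒0<n∸m a<b)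
      (ℕP.≤-<-trans (ℕP.m∸n≤m b a) b<M)
      (trans (rot-+ (b ∸ a) a w) (trans (cong (λ t → rot t w) (ℕP.m+[n∸m]≡n (ℕP.<⇒≤ a<b))) (sym rot≡')))
  ... | tri≈ _ i≡j _ = i≡j
  ... | tri> _ _ j<i = ⊥-elim (no-shift j<i i<M (sym rot≡))
    where
    no-shift : {a b : ℕ} → a < b → b < suc m → rot a w ≢ rot b w
    no-shift {a} {b} a<b b<M rot≡' = IsLeastPeriod.least (primitive-rot prim a) (ℕP.m<n⇒0<n∸m a<b)
      (ℕP.≤-<-trans (ℕP.m∸n≤m b a) b<M)
      (trans (rot-+ (b ∸ a) a w) (trans (cong (λ t → rot t w) (ℕP.m+[n∸m]≡n (ℕP.<⇒≤ a<b))) (sym rot≡')))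

module _ {A : Set} {m d : ℕ} (1+d∣1+m : suc d ∣ suc m) where

  resize-back : (u : Vec A (suc d)) → resize d (resize m u) ≡ u
  resize-back u = at-ext _ _ λ j → begin
    at (resize d (resize m u)) j     ≡⟨ at-resize d (resize m u) j ⟩
    at (resize m u) (j % suc d)      ≡⟨ at-resize m u (j % suc d) ⟩
    at u (j % suc d % suc m)         ≡⟨ cong (at u) (m<n⇒m%n≡m (ℕP.<-≤-trans (m%n<n j (suc d)) (∣⇒≤ 1+d∣1+m))) ⟩
    at u (j % suc d)                 ≡⟨ at-mod u j ⟩
    at u j                           ∎
    where open ≡-Reasoning

  resize-periodic : (w : Vec A (suc m)) → rot (suc d) w ≡ w → resize m (resize d w) ≡ w
  resize-periodic w rot-d≡w = at-ext _ _ λ j → begin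
    at (resize m (resize d w)) j     ≡⟨ at-resize m (resize d w) j ⟩
    at (resize d w) (j % suc m)      ≡⟨ at-resize d w (j % suc m) ⟩
    at w (j % suc m % suc d)         ≡⟨ cong (at w) (m∣n⇒o%n%m≡o%m (suc d) (suc m) j 1+d∣1+m) ⟩
    at w (j % suc d)                 ≡⟨ sym (at-periodic (suc d) w rot-d≡w j) ⟩
    at w j                           ∎
    where open ≡-Reasoning

  rot-resize : (e : ℕ) (u : Vec A (suc d)) → rot e (resize m u) ≡ resize m (rot e u)
  rot-resize e u = at-ext _ _ λ j → begin
    at (rot e (resize m u)) j        ≡⟨ at-rot e (resize m u) j ⟩
    at (resize m u) (j + e)          ≡⟨ at-resize m u (j + e) ⟩
    at u ((j + e) % suc m)           ≡⟨ at-cong-mod u ((j + e) % suc m) (j % suc m + e) (begin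
      (j + e) % suc m % suc d                     ≡⟨ m∣n⇒o%n%m≡o%m (suc d) (suc m) (j + e) 1+d∣1+m ⟩
      (j + e) % suc d                             ≡⟨ %-distribˡ-+ j e (suc d) ⟩
      (j % suc d + e % suc d) % suc d
        ≡⟨ cong (λ t → (t + e % suc d) % suc d) (sym (m∣n⇒o%n%m≡o%m (suc d) (suc m) j 1+d∣1+m)) ⟩
      (j % suc m % suc d + e % suc d) % suc d     ≡⟨ sym (%-distribˡ-+ (j % suc m) e (suc d)) ⟩
      (j % suc m + e) % suc d                     ∎) ⟩
    at u (j % suc m + e)             ≡⟨ sym (at-rot e u (j % suc m)) ⟩
    at (rot e u) (j % suc m)         ≡⟨ sym (at-resize m (rot e u) j) ⟩
    at (resize m (rot e u)) j        ∎
    where open ≡-Reasoning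

  resize-leastPeriod : {u : Vec A (suc d)} → IsLeastPeriod u (suc d) → IsLeastPeriod (resize m u) (suc d)
  resize-leastPeriod {u} prim = record
    { positive = s≤s z≤n
    ; fixes    = trans (rot-resize (suc d) u) (cong (resize m) (rot-length u))
    ; least    = λ {e} 0<e e<d rot-e≡ → IsLeastPeriod.least prim 0<e e<d (begin
        rot e u                          ≡⟨ sym (resize-back (rot e u)) ⟩
        resize d (resize m (rot e u))    ≡⟨ cong (resize d) (sym (rot-resize e u)) ⟩
        resize d (rot e (resize m u))    ≡⟨ cong (resize d) rot-e≡ ⟩
        resize d (resize m u)            ≡⟨ resize-back u ⟩
        u                                ∎)
    }
    where open ≡-Reasoning

  resize-back-leastPeriod : {w : Vec A (suc m)} → IsLeastPeriod w (suc d) → IsLeastPeriod (resize d w) (suc d)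
  resize-back-leastPeriod {w} per = record
    { positive = s≤s z≤n
    ; fixes    = rot-length (resize d w)
    ; least    = λ {e} 0<e e<d rot-e≡ → IsLeastPeriod.least per 0<e e<d (begin
        rot e w                          ≡⟨ cong (rot e) (sym w≡) ⟩
        rot e (resize m (resize d w))    ≡⟨ rot-resize e (resize d w) ⟩
        resize m (rot e (resize d w))    ≡⟨ cong (resize m) rot-e≡ ⟩
        resize m (resize d w)            ≡⟨ w≡ ⟩
        w                                ∎)
    }
    where
    open ≡-Reasoning
    w≡ : resize m (resize d w) ≡ w
    w≡ = resize-periodic w (IsLeastPeriod.fixes per)

-- Least rotations and row-Lyndon patterns

open module PatternOrder {k m n : ℕ} = CmpOrder (cmpPat-lawful k m n)

_≟ᴾ_ : {k m n : ℕ} → DecidableEquality (Pattern k m n)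
_≟ᴾ_ = VecP.≡-dec (VecP.≡-dec Fin._≟_)

module _ {k m n : ℕ} where

  foldr-minPat-minimum : (z : Pattern k m n) (xs : List (Pattern k m n)) →
    foldr minPat z xs ∈ z ∷ xs × (∀ {y} → y ∈ z ∷ xs → foldr minPat z xs ≼ y)
  foldr-minPat-minimum z [] = here refl , λ { (here refl) → ≼-refl }
  foldr-minPat-minimum z (x ∷ xs) with foldr-minPat-minimum z xs | foldr minPat z xs <ᵖ x in min<x
  ... | min∈ , min≼ | true  = ∈-skip min∈ , λ { (here refl) → min≼ (here refl)
                                               ; (there (here refl)) → ≺⇒≼ (isLt⇒≺ min<x)
                                               ; (there (there y∈xs)) → min≼ (there y∈xs) }
    where
    ∈-skip : foldr minPat z xs ∈ z ∷ xs → foldr minPat z xs ∈ z ∷ x ∷ xs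
    ∈-skip (here ≡z)   = here ≡z
    ∈-skip (there y∈) = there (there y∈)
  ... | min∈ , min≼ | false = there (here refl) , λ { (here refl) → ≼-trans (¬isLt⇒⊀ min<x) (min≼ (here refl))
                                                     ; (there (here refl)) → ≼-refl
                                                     ; (there (there y∈xs)) → ≼-trans (¬isLt⇒⊀ min<x) (min≼ (there y∈xs)) }

module _ {k m n : ℕ} where

  lexmin-rotation : (P : Pattern k (suc m) n) → ∃[ a ] (a < suc m × lexmin P ≡ rot a P)
  lexmin-rotation P with proj₁ (foldr-minPat-minimum P (map (λ i → rot i P) (upTo (suc m))))
  ... | here lexmin≡P = 0 , s≤s z≤n , lexmin≡P
  ... | there lexmin∈ with ∈-map⁻ (λ i → rot i P) lexmin∈
  ...   | a , a∈ , lexmin≡ = a , ∈-upTo⁻ a∈ , lexmin≡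

  lexmin-≼ : (P : Pattern k (suc m) n) (i : ℕ) → lexmin P ≼ rot i P
  lexmin-≼ P i = subst (lexmin P ≼_) (rot-mod i P)
    (proj₂ (foldr-minPat-minimum P (map (λ j → rot j P) (upTo (suc m))))
      (there (∈-map⁺ (λ j → rot j P) (∈-upTo⁺ (m%n<n i (suc m))))))

  rot-undo : (j b : ℕ) (P : Pattern k (suc m) n) → rot (j * m + b) (rot j P) ≡ rot b P
  rot-undo j b P = trans (rot-+ (j * m + b) j P) (rot-cong-mod (j + (j * m + b)) b P (begin
    (j + (j * m + b)) % suc m   ≡⟨ cong (_% suc m) (trans (sym (ℕP.+-assoc j (j * m) b)) (ℕP.+-comm (j + j * m) b)) ⟩
    (b + (j + j * m)) % suc m   ≡⟨ cong (λ t → (b + t) % suc m) (trans (sym (ℕP.*-suc j m)) (ℕP.*-comm j (suc m))) ⟩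
    (b + suc m * j) % suc m     ≡⟨ cong (λ t → (b + t) % suc m) (ℕP.*-comm (suc m) j) ⟩
    (b + j * suc m) % suc m     ≡⟨ [m+kn]%n≡m%n b j (suc m) ⟩
    b % suc m                   ∎))
    where open ≡-Reasoning

  lexmin-rot : (P : Pattern k (suc m) n) (j : ℕ) → lexmin (rot j P) ≡ lexmin P
  lexmin-rot P j with lexmin-rotation (rot j P) | lexmin-rotation P
  ... | a , _ , lexmin-jP≡ | b , _ , lexmin-P≡ = ≼-antisym
    (subst (lexmin (rot j P) ≼_) (trans (rot-undo j b P) (sym lexmin-P≡)) (lexmin-≼ (rot j P) (j * m + b)))
    (subst (lexmin P ≼_) (sym (trans lexmin-jP≡ (rot-+ a j P))) (lexmin-≼ P (j + a)))

  lexmin-idem : (P : Pattern k (suc m) n) → lexmin (lexmin P) ≡ lexmin P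
  lexmin-idem P with lexmin-rotation P
  ... | a , _ , lexmin≡ = trans (cong lexmin lexmin≡) (lexmin-rot P a)

  isRowLyndon⁻ : {P : Pattern k (suc m) n} → isRowLyndon P ≡ true → ∀ {i} → i < m → P ≺ rot (suc i) P
  isRowLyndon⁻ {P} lyn i<m = isLt⇒≺ (allB⁻ (λ i → P <ᵖ rot (suc i) P) (upTo m) lyn (∈-upTo⁺ i<m))

  isRowLyndon⁺ : {P : Pattern k (suc m) n} → (∀ {i} → i < m → P ≺ rot (suc i) P) → isRowLyndon P ≡ true
  isRowLyndon⁺ {P} below-rotations = allB⁺ (λ i → P <ᵖ rot (suc i) P) (upTo m) (λ i∈ → ≺⇒isLt (below-rotations (∈-upTo⁻ i∈)))

  rowLyndon⇒lexmin≡ : {P : Pattern k (suc m) n} → isRowLyndon P ≡ true → lexmin P ≡ P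
  rowLyndon⇒lexmin≡ {P} lyn with lexmin-rotation P
  ... | zero  , _         , lexmin≡ = lexmin≡
  ... | suc a , s≤s a<m , lexmin≡ = ⊥-elim (lexmin-≼ P 0 (subst (P ≺_) (sym lexmin≡) (isRowLyndon⁻ lyn a<m)))

-- Counting patterns by least period

countB-++ : {A : Set} (p : A → Bool) (xs ys : List A) → countB p (xs ++ ys) ≡ countB p xs + countB p ys
countB-++ p []       ys = refl
countB-++ p (x ∷ xs) ys with p x
... | true  = cong suc (countB-++ p xs ys)
... | false = countB-++ p xs ys

countB-proj₁-cartesianProduct : {A B : Set} (p : A → Bool) (xs : List A) (ys : List B) →
  countB (p ∘ proj₁) (cartesianProduct xs ys) ≡ countB p xs * length ys
countB-proj₁-cartesianProduct p []       ys = refl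
countB-proj₁-cartesianProduct {B = B} p (x ∷ xs) ys with p x in px
... | true  = trans (countB-++ (p ∘ proj₁) (map (x ,_) ys) _) (cong₂ _+_ (row ys) (countB-proj₁-cartesianProduct p xs ys))
  where
  row : (zs : List B) → countB (p ∘ proj₁) (map (x ,_) zs) ≡ length zs
  row []       = refl
  row (z ∷ zs) rewrite px = cong suc (row zs)
... | false = trans (countB-++ (p ∘ proj₁) (map (x ,_) ys) _) (cong₂ _+_ (row ys) (countB-proj₁-cartesianProduct p xs ys))
  where
  row : (zs : List B) → countB (p ∘ proj₁) (map (x ,_) zs) ≡ 0
  row []       = refl
  row (z ∷ zs) rewrite px = row zs

+-^ : (q N : ℕ) → (+ q) ℤ.^ N ≡ + (q ^ N)
+-^ q zero    = refl
+-^ q (suc N) = trans (cong (+ q ℤ.*_) (+-^ q N)) (sym (ℤP.pos-* q (q ^ N)))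

module PatternCounting (k n : ℕ) where

  _≟ʳ_ : DecidableEquality (Vec (Fin k) n)
  _≟ʳ_ = VecP.≡-dec Fin._≟_

  hasPeriod : {m : ℕ} → ℕ → Pattern k (suc m) n → Bool
  hasPeriod d P = ⌊ d ℕ.≟ period _≟ʳ_ P ⌋

  hasPeriod⁺ : {m d : ℕ} {P : Pattern k (suc m) n} → IsLeastPeriod P d → hasPeriod d P ≡ true
  hasPeriod⁺ {d = d} {P} per = ⌊⌋-true (d ℕ.≟ period _≟ʳ_ P) (leastPeriod-unique per (period-isLeast _≟ʳ_ P))

  hasPeriod⁻ : {m d : ℕ} {P : Pattern k (suc m) n} → hasPeriod d P ≡ true → IsLeastPeriod P d
  hasPeriod⁻ {d = d} {P} h = subst (IsLeastPeriod P) (sym (⌊⌋-true⁻ (d ℕ.≟ period _≟ʳ_ P) h)) (period-isLeast _≟ʳ_ P)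

  lyndonCount : ℕ → ℕ
  lyndonCount d = countB isRowLyndon (allPat k d n)

  rowLyndon⇒primitive : {m : ℕ} {P : Pattern k (suc m) n} → isRowLyndon P ≡ true → IsLeastPeriod P (suc m)
  rowLyndon⇒primitive {P = P} lyn = record
    { positive = s≤s z≤n
    ; fixes    = rot-length P
    ; least    = λ { {suc i} _ (s≤s i<m) rot≡P → ≺-irrefl (subst (P ≺_) rot≡P (isRowLyndon⁻ lyn i<m)) }
    }

  primitive⇒rowLyndon-lexmin : {m : ℕ} {P : Pattern k (suc m) n} → IsLeastPeriod P (suc m) → isRowLyndon (lexmin P) ≡ true
  primitive⇒rowLyndon-lexmin {m} {P} prim with lexmin-rotation P
  ... | a , _ , lexmin≡ = isRowLyndon⁺ (λ {i} i<m → ≼∧≢⇒≺ (below i) (distinct i<m))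
    where
    below : ∀ i → lexmin P ≼ rot (suc i) (lexmin P)
    below i = subst (lexmin P ≼_) (sym (trans (cong (rot (suc i)) lexmin≡) (rot-+ (suc i) a P))) (lexmin-≼ P (a + suc i))
    distinct : ∀ {i} → i < m → lexmin P ≢ rot (suc i) (lexmin P)
    distinct {i} i<m lexmin≡rot = IsLeastPeriod.least (primitive-rot prim a) (s≤s z≤n) (s≤s i<m)
      (trans (cong (rot (suc i)) (sym lexmin≡)) (trans (sym lexmin≡rot) lexmin≡))

  module _ {d : ℕ} where

    rotationIndex : Pattern k (suc d) n → Fin (suc d)
    rotationIndex P = fromℕ< (m%n<n (suc d ∸ proj₁ (lexmin-rotation P)) (suc d))

    rot-rotationIndex : (P : Pattern k (suc d) n) → rot (toℕ (rotationIndex P)) (lexmin P) ≡ P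
    rot-rotationIndex P with lexmin-rotation P
    ... | a , a<D , lexmin≡ = begin
      rot (toℕ (fromℕ< (m%n<n (suc d ∸ a) (suc d)))) (lexmin P)
        ≡⟨ cong (λ t → rot t (lexmin P)) (FinP.toℕ-fromℕ< (m%n<n (suc d ∸ a) (suc d))) ⟩
      rot ((suc d ∸ a) % suc d) (lexmin P)                      ≡⟨ rot-mod (suc d ∸ a) (lexmin P) ⟩
      rot (suc d ∸ a) (lexmin P)                                ≡⟨ cong (rot (suc d ∸ a)) lexmin≡ ⟩
      rot (suc d ∸ a) (rot a P)                                 ≡⟨ rot-+ (suc d ∸ a) a P ⟩
      rot (a + (suc d ∸ a)) P                                   ≡⟨ cong (λ t → rot t P) (ℕP.m+[n∸m]≡n (ℕP.<⇒≤ a<D)) ⟩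
      rot (suc d) P                                             ≡⟨ rot-length P ⟩
      P                                                         ∎
      where open ≡-Reasoning

    lyndon×rotation-bijection : SubsetBijection (isRowLyndon ∘ proj₁) (hasPeriod (suc d))
    lyndon×rotation-bijection = record
      { to      = λ (L , i) → rot (toℕ i) L
      ; from    = λ P → lexmin P , rotationIndex P
      ; to-∈    = λ { {L , i} lyn → hasPeriod⁺ (primitive-rot (rowLyndon⇒primitive lyn) (toℕ i)) }
      ; from-∈  = λ h → primitive⇒rowLyndon-lexmin (hasPeriod⁻ h)
      ; from-to = λ { {L , i} lyn → from-to L i lyn }
      ; to-from = λ {P} _ → rot-rotationIndex P
      }
      where
      from-to : (L : Pattern k (suc d) n) (i : Fin (suc d)) → isRowLyndon L ≡ true →
        (lexmin (rot (toℕ i) L) , rotationIndex (rot (toℕ i) L)) ≡ (L , i)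
      from-to L i lyn = cong₂ _,_ lexmin≡L (FinP.toℕ-injective
        (primitive-rot-injective (rowLyndon⇒primitive lyn) (FinP.toℕ<n (rotationIndex (rot (toℕ i) L))) (FinP.toℕ<n i)
          (trans (cong (rot (toℕ (rotationIndex (rot (toℕ i) L)))) (sym lexmin≡L)) (rot-rotationIndex (rot (toℕ i) L)))))
        where
        lexmin≡L : lexmin (rot (toℕ i) L) ≡ L
        lexmin≡L = trans (lexmin-rot L (toℕ i)) (rowLyndon⇒lexmin≡ lyn)

    primitive-count : countB (hasPeriod (suc d)) (allPat k (suc d) n) ≡ suc d * lyndonCount (suc d)
    primitive-count = begin
      countB (hasPeriod (suc d)) (allPat k (suc d) n)
        ≡⟨ sym (countB-bijection (ProdP.≡-dec _≟ᴾ_ Fin._≟_) _≟ᴾ_ lyndon×rotation-bijection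
                 (cartesianProduct-enumerates (allPat-enumerates k (suc d) n) (allFin-enumerates (suc d)))
                 (allPat-enumerates k (suc d) n)) ⟩
      countB (isRowLyndon ∘ proj₁) (cartesianProduct (allPat k (suc d) n) (allFin (suc d)))
        ≡⟨ countB-proj₁-cartesianProduct isRowLyndon (allPat k (suc d) n) (allFin (suc d)) ⟩
      lyndonCount (suc d) * length (allFin (suc d))
        ≡⟨ cong (lyndonCount (suc d) *_) (ListP.length-tabulate id) ⟩
      lyndonCount (suc d) * suc d
        ≡⟨ ℕP.*-comm (lyndonCount (suc d)) (suc d) ⟩
      suc d * lyndonCount (suc d) ∎
      where open ≡-Reasoning

  periodic-count : {m d : ℕ} → suc d ∣ suc m →
    countB (hasPeriod (suc d)) (allPat k (suc m) n) ≡ countB (hasPeriod (suc d)) (allPat k (suc d) n)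
  periodic-count {m} {d} 1+d∣1+m = countB-bijection _≟ᴾ_ _≟ᴾ_ β (allPat-enumerates k (suc m) n) (allPat-enumerates k (suc d) n)
    where
    β : SubsetBijection (hasPeriod (suc d)) (hasPeriod (suc d))
    β = record
      { to      = resize d
      ; from    = resize m
      ; to-∈    = λ h → hasPeriod⁺ (resize-back-leastPeriod 1+d∣1+m (hasPeriod⁻ h))
      ; from-∈  = λ h → hasPeriod⁺ (resize-leastPeriod 1+d∣1+m (hasPeriod⁻ h))
      ; from-to = λ {P} h → resize-periodic 1+d∣1+m P (IsLeastPeriod.fixes (hasPeriod⁻ h))
      ; to-from = λ {P} _ → resize-back 1+d∣1+m P
      }

  divisorSum-hasPeriod : {m : ℕ} (P : Pattern k (suc m) n) → divisorSum (suc m) (λ d → 𝟙 (hasPeriod d P)) ≡ 1ℤ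
  divisorSum-hasPeriod {m} P = trans (∑-cong (range1 (suc m)) only-period)
    (∑-pick ℕ._≟_ (λ _ → 1ℤ) (range1-unique (suc m)) (∣⇒∈-range1 (s≤s z≤n) (period-∣ _≟ʳ_ P) ℕP.≤-refl))
    where
    only-period : ∀ d → (if ⌊ d ∣? suc m ⌋ then 𝟙 (hasPeriod d P) else 0ℤ) ≡ 𝟙 (hasPeriod d P)
    only-period d with d ∣? suc m
    ... | yes _   = refl
    ... | no d∤M rewrite ⌊⌋-false (d ℕ.≟ period _≟ʳ_ P) (λ { refl → d∤M (period-∣ _≟ʳ_ P) }) = refl

  words-by-period : {M : ℕ} → 0 < M → divisorSum M (λ d → + (d * lyndonCount d)) ≡ (+ (k ^ n)) ℤ.^ M
  words-by-period {suc m} _ = begin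
    divisorSum (suc m) (λ d → + (d * lyndonCount d))
      ≡⟨ divisorSum-cong (suc m) count-by-divisor ⟩
    divisorSum (suc m) (λ d → + countB (hasPeriod d) (allPat k (suc m) n))
      ≡⟨ divisorSum-cong (suc m) (λ {d} _ → +-countB (hasPeriod d) (allPat k (suc m) n)) ⟩
    divisorSum (suc m) (λ d → ∑ (allPat k (suc m) n) (λ P → 𝟙 (hasPeriod d P)))
      ≡⟨ divisorSum-∑ (suc m) (allPat k (suc m) n) (λ d P → 𝟙 (hasPeriod d P)) ⟩
    ∑ (allPat k (suc m) n) (λ P → divisorSum (suc m) (λ d → 𝟙 (hasPeriod d P)))
      ≡⟨ ∑-cong (allPat k (suc m) n) divisorSum-hasPeriod ⟩
    ∑ (allPat k (suc m) n) (λ _ → 1ℤ)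
      ≡⟨ sym (+-length (allPat k (suc m) n)) ⟩
    + length (allPat k (suc m) n)
      ≡⟨ cong +_ (length-allPat k (suc m) n) ⟩
    + ((k ^ n) ^ suc m)
      ≡⟨ sym (+-^ (k ^ n) (suc m)) ⟩
    (+ (k ^ n)) ℤ.^ suc m ∎
    where
    open ≡-Reasoning
    count-by-divisor : ∀ {d} → d ∣ suc m → + (d * lyndonCount d) ≡ + countB (hasPeriod d) (allPat k (suc m) n)
    count-by-divisor {suc d} 1+d∣1+m = cong +_ (sym (trans (periodic-count 1+d∣1+m) primitive-count))
    count-by-divisor {zero}  0∣1+m   = ⊥-elim (ℕP.1+n≢0 (0∣⇒≡0 0∣1+m))

-- Edges of the ring graph

∧-true⁻ : {a b : Bool} → (a ∧ b) ≡ true → a ≡ true × b ≡ true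
∧-true⁻ h = ∧-conicalˡ _ _ h , ∧-conicalʳ _ _ h

cast-++-[-] : {A : Set} {n : ℕ} .(e : n + 1 ≡ suc n) (c : Vec A n) (r : A) → Vec.cast e (c Vec.++ (r ∷ [])) ≡ c ∷ʳ r
cast-++-[-] e []      r = refl
cast-++-[-] e (x ∷ c) r = cong (x ∷_) (cast-++-[-] (cong ℕ.pred e) c r)

module RingGraph (k m n' : ℕ) where

  Pat : ℕ → Set
  Pat w = Pattern k (suc m) w

  firstColumn : {w : ℕ} → Pat (suc w) → Pat 1
  firstColumn = Vec.map (λ r → Vec.head r ∷ [])

  dropFirstColumn : {w : ℕ} → Pat (suc w) → Pat w
  dropFirstColumn = Vec.map Vec.tail

  dropLastColumn : {w : ℕ} → Pat (suc w) → Pat w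
  dropLastColumn = Vec.map Vec.init

  lastColumn : {w : ℕ} → Pat (suc w) → Pat 1
  lastColumn = Vec.map (λ r → Vec.last r ∷ [])

  firstColumn-hcat : {j : ℕ} (L : Vec (Vec (Fin k) 1) j) {w : ℕ} (C : Vec (Vec (Fin k) w) j) →
    Vec.map (λ r → Vec.head r ∷ []) (hcat L C) ≡ L
  firstColumn-hcat []              []      = refl
  firstColumn-hcat ((l ∷ []) ∷ L) (c ∷ C) = cong ((l ∷ []) ∷_) (firstColumn-hcat L C)

  dropFirstColumn-hcat : {j : ℕ} (L : Vec (Vec (Fin k) 1) j) {w : ℕ} (C : Vec (Vec (Fin k) w) j) → Vec.map Vec.tail (hcat L C) ≡ C
  dropFirstColumn-hcat []              []      = refl
  dropFirstColumn-hcat ((l ∷ []) ∷ L) (c ∷ C) = cong (c ∷_) (dropFirstColumn-hcat L C)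

  dropLastColumn-catLCR : {j : ℕ} (L : Vec (Vec (Fin k) 1) j) (C : Vec (Vec (Fin k) n') j) (R : Vec (Vec (Fin k) 1) j) →
    Vec.map Vec.init (hcat L (castW (ℕP.+-comm n' 1) (hcat C R))) ≡ hcat L C
  dropLastColumn-catLCR []              []      []              = refl
  dropLastColumn-catLCR ((l ∷ []) ∷ L) (c ∷ C) ((r ∷ []) ∷ R) = cong₂ _∷_
    (cong (l ∷_) (trans (cong Vec.init (cast-++-[-] (ℕP.+-comm n' 1) c r)) (VecP.init-∷ʳ r c)))
    (dropLastColumn-catLCR L C R)

  catLCR-columns : {j : ℕ} (X : Vec (Vec (Fin k) (suc (suc n'))) j) →
    hcat (Vec.map (λ r → Vec.head r ∷ []) X)
         (castW (ℕP.+-comm n' 1) (hcat (Vec.map (Vec.init ∘ Vec.tail) X) (Vec.map (λ r → Vec.last r ∷ []) X))) ≡ X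
  catLCR-columns []            = refl
  catLCR-columns ((l ∷ u) ∷ X) = cong₂ _∷_
    (cong (l ∷_) (trans (cast-++-[-] (ℕP.+-comm n' 1) (Vec.init u) (Vec.last u)) (sym (proj₂ (proj₂ (Vec.initLast u))))))
    (catLCR-columns X)

  hcat-first-middle : {j : ℕ} (X : Vec (Vec (Fin k) (suc (suc n'))) j) →
    hcat (Vec.map (λ r → Vec.head r ∷ []) X) (Vec.map (Vec.init ∘ Vec.tail) X) ≡ Vec.map Vec.init X
  hcat-first-middle []            = refl
  hcat-first-middle ((l ∷ u) ∷ X) = cong ((l ∷ Vec.init u) ∷_) (hcat-first-middle X)

  hcat-injective : {L L' : Pat 1} {C C' : Pat n'} → hcat L C ≡ hcat L' C' → L ≡ L' × C ≡ C'
  hcat-injective {L} {L'} {C} {C'} hcat≡ =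
    trans (sym (firstColumn-hcat L C)) (trans (cong firstColumn hcat≡) (firstColumn-hcat L' C')) ,
    trans (sym (dropFirstColumn-hcat L C)) (trans (cong dropFirstColumn hcat≡) (dropFirstColumn-hcat L' C'))

  isVertex⁻ : {P : Pat (suc n')} → isVertex P ≡ true → lexmin P ≡ P
  isVertex⁻ {P} h with anyB⁻ _ (allPat k (suc m) (suc n')) h
  ... | S , _ , lexmin-S≡P = let S≡ = ⌊⌋-true⁻ (lexmin S ≟ᴾ P) lexmin-S≡P in
    trans (cong lexmin (sym S≡)) (trans (lexmin-idem S) S≡)

  isVertex⁺ : {P : Pat (suc n')} → lexmin P ≡ P → isVertex P ≡ true
  isVertex⁺ {P} lexmin≡ = anyB⁺ _ (allPat k (suc m) (suc n')) (Enumerates.complete (allPat-enumerates k (suc m) (suc n')) P)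
    (⌊⌋-true (lexmin P ≟ᴾ P) lexmin≡)

  record EdgeWitness (P₁ P₂ : Pat (suc n')) (R : Pat 1) : Set where
    field
      L       : Pat 1
      C       : Pat n'
      P₁≡     : P₁ ≡ hcat L C
      P₂≡     : P₂ ≡ lexmin (catCR C R)
      lyndon  : isRowLyndon (lexmin (catLCR L C R)) ≡ true
      minimal : ∀ {R'} → R' ≺ R → lexmin (catLCR L C R') ≢ lexmin (catLCR L C R)

  isEdge⁻ : {P₁ P₂ : Pat (suc n')} {R : Pat 1} → isEdge P₁ P₂ R ≡ true → EdgeWitness P₁ P₂ R
  isEdge⁻ {P₁} {P₂} {R} h with anyB⁻ _ (allPat k (suc m) 1) h
  ... | L , _ , h' with anyB⁻ _ (allPat k (suc m) n') h'
  ... | C , _ , conditions with ∧-true⁻ conditions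
  ... | P₁≡ , conditions' with ∧-true⁻ conditions'
  ... | P₂≡ , conditions'' with ∧-true⁻ conditions''
  ... | lyndon , no-smaller = record
    { L = L ; C = C ; P₁≡ = ⌊⌋-true⁻ (P₁ ≟ᴾ hcat L C) P₁≡ ; P₂≡ = ⌊⌋-true⁻ (P₂ ≟ᴾ lexmin (catCR C R)) P₂≡
    ; lyndon = lyndon
    ; minimal = λ {R'} R'≺R same → false≢true (trans
        (sym (anyB-false⁻ _ (allPat k (suc m) 1) (not≡true⇒≡false no-smaller) (Enumerates.complete (allPat-enumerates k (suc m) 1) R')))
        (cong₂ _∧_ (≺⇒isLt R'≺R) (⌊⌋-true (lexmin (catLCR L C R') ≟ᴾ lexmin (catLCR L C R)) same)))
    }

  isEdge⁺ : {P₁ P₂ : Pat (suc n')} {R : Pat 1} → EdgeWitness P₁ P₂ R → isEdge P₁ P₂ R ≡ true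
  isEdge⁺ {P₁} {P₂} {R} w =
    anyB⁺ _ (allPat k (suc m) 1) (Enumerates.complete (allPat-enumerates k (suc m) 1) L)
      (anyB⁺ _ (allPat k (suc m) n') (Enumerates.complete (allPat-enumerates k (suc m) n') C)
        (cong₂ _∧_ (⌊⌋-true (P₁ ≟ᴾ hcat L C) P₁≡) (cong₂ _∧_ (⌊⌋-true (P₂ ≟ᴾ lexmin (catCR C R)) P₂≡)
          (cong₂ _∧_ lyndon (cong not (anyB-false⁺ _ (allPat k (suc m) 1) (λ {R'} _ → no-smaller R')))))))
    where
    open EdgeWitness w
    no-smaller : ∀ R' → ((R' <ᵖ R) ∧ (lexmin (catLCR L C R') ≟ᵖ lexmin (catLCR L C R))) ≡ false
    no-smaller R' with R' <ᵖ R in R'<R | lexmin (catLCR L C R') ≟ᴾ lexmin (catLCR L C R)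
    ... | true  | yes same = ⊥-elim (minimal (isLt⇒≺ R'<R) same)
    ... | true  | no _     = refl
    ... | false | _        = refl

  Triple : Set
  Triple = Pat (suc n') × Pat (suc n') × Pat 1

  isEdgeTriple : Triple → Bool
  isEdgeTriple (P₁ , P₂ , R) = isVertex P₁ ∧ isVertex P₂ ∧ isEdge P₁ P₂ R

  -- The Booleans are given explicitly: inferring them would unfold isVertex and isEdge.
  isEdgeTriple⁻ : {P₁ P₂ : Pat (suc n')} {R : Pat 1} → isEdgeTriple (P₁ , P₂ , R) ≡ true →
    lexmin P₁ ≡ P₁ × EdgeWitness P₁ P₂ R
  isEdgeTriple⁻ {P₁} {P₂} {R} h =
    isVertex⁻ (∧-conicalˡ (isVertex P₁) _ h) ,
    isEdge⁻ (∧-conicalʳ (isVertex P₂) (isEdge P₁ P₂ R) (∧-conicalʳ (isVertex P₁) (isVertex P₂ ∧ isEdge P₁ P₂ R) h))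

  triples : List Triple
  triples = concatMap (λ P₁ → concatMap (λ P₂ → map (λ R → P₁ , P₂ , R) (allPat k (suc m) 1))
                                        (allPat k (suc m) (suc n')))
                      (allPat k (suc m) (suc n'))

  triples-enumerates : Enumerates triples
  triples-enumerates = subst Enumerates (sym triples≡)
    (cartesianProduct-enumerates (allPat-enumerates k (suc m) (suc n'))
      (cartesianProduct-enumerates (allPat-enumerates k (suc m) (suc n')) (allPat-enumerates k (suc m) 1)))
    where
    Ps : List (Pat (suc n'))
    Ps = allPat k (suc m) (suc n')
    Rs : List (Pat 1)
    Rs = allPat k (suc m) 1
    triples≡ : triples ≡ cartesianProduct Ps (cartesianProduct Ps Rs)
    triples≡ = begin
      concatMap (λ P₁ → concatMap (λ P₂ → map (λ R → P₁ , P₂ , R) Rs) Ps) Ps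
        ≡⟨ ListP.concatMap-cong (λ P₁ → begin
             concatMap (λ P₂ → map (λ R → P₁ , P₂ , R) Rs) Ps         ≡⟨ ListP.concatMap-cong (λ P₂ → ListP.map-∘ Rs) Ps ⟩
             concatMap (λ P₂ → map (P₁ ,_) (map (P₂ ,_) Rs)) Ps
               ≡⟨ sym (ListP.map-concatMap (P₁ ,_) (λ P₂ → map (P₂ ,_) Rs) Ps) ⟩
             map (P₁ ,_) (concatMap (λ P₂ → map (P₂ ,_) Rs) Ps)
               ≡⟨ cong (map (P₁ ,_)) (concatMap-map≡cartesianProductWith _,_ Ps Rs) ⟩
             map (P₁ ,_) (cartesianProduct Ps Rs)                     ∎) Ps ⟩
      concatMap (λ P₁ → map (P₁ ,_) (cartesianProduct Ps Rs)) Ps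
        ≡⟨ concatMap-map≡cartesianProductWith _,_ Ps (cartesianProduct Ps Rs) ⟩
      cartesianProduct Ps (cartesianProduct Ps Rs) ∎
      where open ≡-Reasoning

  closingPattern : Triple → Pat (suc (suc n'))
  closingPattern (P₁ , P₂ , R) = lexmin (catLCR (firstColumn P₁) (dropFirstColumn P₁) R)

  -- Rotate Q so that its first n - 1 columns become a vertex [L , C]; the edge of Q is then
  -- [L , C] → lexmin [C , R₀] labelled by the least column R₀ with lexmin [L , C , R₀] = lexmin Q.
  module EdgeOf (Q : Pat (suc (suc n'))) where

    j : ℕ
    j = proj₁ (lexmin-rotation (dropLastColumn Q))

    L : Pat 1
    L = firstColumn (rot j Q)

    C : Pat n'
    C = Vec.map (Vec.init ∘ Vec.tail) (rot j Q)

    LC≡lexmin : hcat L C ≡ lexmin (dropLastColumn Q)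
    LC≡lexmin = begin
      hcat L C                   ≡⟨ hcat-first-middle (rot j Q) ⟩
      dropLastColumn (rot j Q)   ≡⟨ sym (rot-map Vec.init j Q) ⟩
      rot j (dropLastColumn Q)   ≡⟨ sym (proj₂ (proj₂ (lexmin-rotation (dropLastColumn Q)))) ⟩
      lexmin (dropLastColumn Q)  ∎
      where open ≡-Reasoning

    closes : Pat 1 → Bool
    closes R = lexmin (catLCR L C R) ≟ᵖ lexmin Q

    last-closes : closes (lastColumn (rot j Q)) ≡ true
    last-closes = ⌊⌋-true (_ ≟ᴾ lexmin Q) (trans (cong lexmin (catLCR-columns (rot j Q))) (lexmin-rot Q j))

    least-closing : ∃[ R ] (closes R ≡ true × ∀ {R'} → R' ∈ allPat k (suc m) 1 → closes R' ≡ true → R ≼ R')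
    least-closing = minimum-∃ closes (allPat k (suc m) 1)
                      (Enumerates.complete (allPat-enumerates k (suc m) 1) (lastColumn (rot j Q))) last-closes

    R₀ : Pat 1
    R₀ = proj₁ least-closing

    R₀-closes : lexmin (catLCR L C R₀) ≡ lexmin Q
    R₀-closes = ⌊⌋-true⁻ (_ ≟ᴾ lexmin Q) (proj₁ (proj₂ least-closing))

    R₀-least : ∀ {R} → lexmin (catLCR L C R) ≡ lexmin Q → R₀ ≼ R
    R₀-least {R} closes-R = proj₂ (proj₂ least-closing) (Enumerates.complete (allPat-enumerates k (suc m) 1) R)
                              (⌊⌋-true (_ ≟ᴾ lexmin Q) closes-R)

    edge : Triple
    edge = hcat L C , lexmin (catCR C R₀) , R₀

    closingPattern-edge : closingPattern edge ≡ lexmin Q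
    closingPattern-edge = trans (cong₂ (λ L' C' → lexmin (catLCR L' C' R₀)) (firstColumn-hcat L C) (dropFirstColumn-hcat L C))
                                R₀-closes

    edge-isEdgeTriple : isRowLyndon Q ≡ true → isEdgeTriple edge ≡ true
    edge-isEdgeTriple lyn = cong₂ _∧_ (isVertex⁺ (trans (cong lexmin LC≡lexmin) (trans (lexmin-idem _) (sym LC≡lexmin))))
      (cong₂ _∧_ (isVertex⁺ (lexmin-idem (catCR C R₀))) (isEdge⁺ (record
        { L = L ; C = C ; P₁≡ = refl ; P₂≡ = refl
        ; lyndon  = subst (λ P → isRowLyndon P ≡ true) (sym (trans R₀-closes (rowLyndon⇒lexmin≡ lyn))) lyn
        ; minimal = λ R'≺R₀ same → R₀-least (trans same R₀-closes) R'≺R₀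
        })))

  -- The rotation taking [L , C , R] to Q takes P₁ = [L , C] to that of dropLastColumn Q, and P₁ is a vertex.
  edge-closingPattern : {t : Triple} → isEdgeTriple t ≡ true → EdgeOf.edge (closingPattern t) ≡ t
  edge-closingPattern {P₁ , P₂ , R} edge-t =
    cong₂ _,_ LC≡P₁ (cong₂ _,_ (trans (cong₂ (λ C' R' → lexmin (catCR C' R')) C≡ R₀≡R) (sym P₂≡)) R₀≡R)
    where
    open EdgeWitness (proj₂ (isEdgeTriple⁻ edge-t))
    Q : Pat (suc (suc n'))
    Q = closingPattern (P₁ , P₂ , R)
    open EdgeOf Q using (R₀; R₀-closes; R₀-least) renaming (L to L₀; C to C₀; LC≡lexmin to L₀C₀≡lexmin)
    Q≡ : Q ≡ lexmin (catLCR L C R)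
    Q≡ = cong₂ (λ L' C' → lexmin (catLCR L' C' R))
           (trans (cong firstColumn P₁≡) (firstColumn-hcat L C)) (trans (cong dropFirstColumn P₁≡) (dropFirstColumn-hcat L C))
    a : ℕ
    a = proj₁ (lexmin-rotation (catLCR L C R))
    LC≡P₁ : hcat L₀ C₀ ≡ P₁
    LC≡P₁ = begin
      hcat L₀ C₀                                    ≡⟨ L₀C₀≡lexmin ⟩
      lexmin (dropLastColumn Q)
        ≡⟨ cong (lexmin ∘ dropLastColumn) (trans Q≡ (proj₂ (proj₂ (lexmin-rotation (catLCR L C R))))) ⟩
      lexmin (dropLastColumn (rot a (catLCR L C R))) ≡⟨ cong lexmin (sym (rot-map Vec.init a (catLCR L C R))) ⟩
      lexmin (rot a (dropLastColumn (catLCR L C R))) ≡⟨ lexmin-rot (dropLastColumn (catLCR L C R)) a ⟩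
      lexmin (dropLastColumn (catLCR L C R))        ≡⟨ cong lexmin (trans (dropLastColumn-catLCR L C R) (sym P₁≡)) ⟩
      lexmin P₁                                     ≡⟨ proj₁ (isEdgeTriple⁻ edge-t) ⟩
      P₁                                            ∎
      where open ≡-Reasoning
    L≡ : L₀ ≡ L
    L≡ = proj₁ (hcat-injective (trans LC≡P₁ P₁≡))
    C≡ : C₀ ≡ C
    C≡ = proj₂ (hcat-injective (trans LC≡P₁ P₁≡))
    lexmin-Q≡ : lexmin Q ≡ lexmin (catLCR L C R)
    lexmin-Q≡ = trans (cong lexmin Q≡) (lexmin-idem _)
    R₀≡R : R₀ ≡ R
    R₀≡R = ≼-antisym
      (R₀-least (trans (cong₂ (λ L' C' → lexmin (catLCR L' C' R)) L≡ C≡) (sym lexmin-Q≡)))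
      (λ R₀≺R → minimal R₀≺R (trans (cong₂ (λ L' C' → lexmin (catLCR L' C' R₀)) (sym L≡) (sym C≡)) (trans R₀-closes lexmin-Q≡)))

  closingPattern-rowLyndon : {t : Triple} → isEdgeTriple t ≡ true → isRowLyndon (closingPattern t) ≡ true
  closingPattern-rowLyndon {P₁ , P₂ , R} edge-t = subst (λ P → isRowLyndon P ≡ true) (sym Q≡) lyndon
    where
    open EdgeWitness (proj₂ (isEdgeTriple⁻ edge-t))
    Q≡ : closingPattern (P₁ , P₂ , R) ≡ lexmin (catLCR L C R)
    Q≡ = cong₂ (λ L' C' → lexmin (catLCR L' C' R))
           (trans (cong firstColumn P₁≡) (firstColumn-hcat L C)) (trans (cong dropFirstColumn P₁≡) (dropFirstColumn-hcat L C))

  edges-bijection : SubsetBijection isEdgeTriple isRowLyndon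
  edges-bijection = record
    { to      = closingPattern
    ; from    = EdgeOf.edge
    ; to-∈    = closingPattern-rowLyndon
    ; from-∈  = λ {Q} lyn → EdgeOf.edge-isEdgeTriple Q lyn
    ; from-to = edge-closingPattern
    ; to-from = λ {Q} lyn → trans (EdgeOf.closingPattern-edge Q) (rowLyndon⇒lexmin≡ lyn)
    }

  ringGraphEdges≡rowLyndonCount : ringGraphEdges k (suc m) (suc (suc n')) ≡ countB isRowLyndon (allPat k (suc m) (suc (suc n')))
  ringGraphEdges≡rowLyndonCount =
    countB-bijection (ProdP.≡-dec _≟ᴾ_ (ProdP.≡-dec _≟ᴾ_ _≟ᴾ_)) _≟ᴾ_ edges-bijection
      triples-enumerates (allPat-enumerates k (suc m) (suc (suc n')))

necklace≡divisorSum : (q m : ℕ) →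
  necklace q (suc m) ≡ divisorSum (suc m) (λ d → μ (suc m ÷ d) ℤ.* (+ q) ℤ.^ d) ℤ./ + suc m
necklace≡divisorSum q m = cong (ℤ._/ + suc m)
  (sym (∑-map suc (upTo (suc m)) (λ d → if ⌊ d ∣? suc m ⌋ then μ (suc m ÷ d) ℤ.* (+ q) ℤ.^ d else 0ℤ)))

+-*-/ : (m L : ℕ) → (+ (suc m * L)) ℤ./ (+ suc m) ≡ + L
+-*-/ m L = trans (ℤP.*-identityˡ _) (cong +_ (trans (cong (_/ suc m) (ℕP.*-comm (suc m) L)) (m*n/n≡m L (suc m))))

lemma2 : (k m n : ℕ) → 2 ≤ k → 2 ≤ m → 2 ≤ n →
         + ringGraphEdges k m n ≡ necklace (k ^ n) m
lemma2 k zero          n              _ () _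
lemma2 k (suc m)       zero           _ _  ()
lemma2 k (suc m)       (suc zero)     _ _  (s≤s ())
lemma2 k (suc m)       (suc (suc n')) _ _  _ = begin
  + ringGraphEdges k (suc m) n                     ≡⟨ cong +_ (RingGraph.ringGraphEdges≡rowLyndonCount k m n') ⟩
  + lyndonCount (suc m)                            ≡⟨ sym (+-*-/ m (lyndonCount (suc m))) ⟩
  + (suc m * lyndonCount (suc m)) ℤ./ + suc m      ≡⟨ cong (ℤ._/ + suc m) (sym (möbius-inversion _ _ words-by-period (s≤s z≤n))) ⟩
  divisorSum (suc m) (λ d → μ (suc m ÷ d) ℤ.* (+ (k ^ n)) ℤ.^ d) ℤ./ + suc m
                                                   ≡⟨ sym (necklace≡divisorSum (k ^ n) m) ⟩
  necklace (k ^ n) (suc m)                         ∎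
  where
  open ≡-Reasoning
  n : ℕ
  n = suc (suc n')
  open PatternCounting k n using (lyndonCount; words-by-period)
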